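{- For every $g\ge 3$ there exist subsets $\Theta_g^1,\Theta_g^2\subseteq V(\mathcal{S}_g)$ such that $\Theta_g^1$ satisfies condition 2 and $\Theta_g^2$ satisfies condition 3.
   Context: Sierpiński graph: $\mathcal{S}_1$ is a triangle whose three vertices are its outmost vertices. Given $\mathcal{S}_g$ with outmost vertices $A_g,B_g,C_g$, take three copies $\mathcal{S}_g^\theta$ ($\theta=1,2,3$) with outmost vertices $A_g^\theta,B_g^\theta,C_g^\theta$, identify $B_g^1$ with $A_g^2$, $C_g^2$ with $B_g^3$, and $C_g^1$ with $A_g^3$; the result is $\mathcal{S}_{g+1}$, with outmost vertices $A_g^1$, $B_g^2$, $C_g^3$. For a graph $G$ and $D\subseteq V(G)$: $P^0_{G,1}(D)=N_G[D]$ (closed neighborhood), $P^{i+1}_{G,1}(D)=\bigcup\{N_G[v]: v\in P^i_{G,1}(D),\ |N_G[v]\setminus P^i_{G,1}(D)|\le 1\}$; the increasing sequence stabilizes at $P^\infty_{G,1}(D)$. A subset $S\subseteq V(\mathcal{S}_g)$ satisfies condition 2 if: (1) $|S|=\frac{3^{g-2}+1}{2}$; (2) the graph obtained from $\mathcal{S}_g$ by removing the vertices of $P^\infty_{\mathcal{S}_g,1}(S)$ and their incident edges is a path starting at one outmost vertex of $\mathcal{S}_g$ and ending at another outmost vertex; (3) the outmost vertex of $\mathcal{S}_g$ not on this path belongs to $S$. A subset $S\subseteq V(\mathcal{S}_g)$ satisfies condition 3 if: (1) $|S|=\frac{3^{g-2}+1}{2}$; (2) $P^\infty_{\mathcal{S}_g,1}(S)=V(\mathcal{S}_g)$;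 (3) none of the three outmost vertices of $\mathcal{S}_g$ is in $S$. -}

module Defs where

open import Data.Nat using (ℕ; zero; suc; _+_; _*_; _∸_; _^_; _≡ᵇ_; _≤ᵇ_)
open import Data.Nat.DivMod using (_/_)
open import Data.Bool using (Bool; true; false; _∧_; _∨_; not; if_then_else_)
open import Data.List using (List; []; _∷_; _++_; map; filterᵇ; length; _∷ʳ_)
open import Data.Bool.ListAction using (any)
open import Data.Empty using (⊥)
open import Data.List.Membership.Propositional using (_∈_; _∉_)
open import Data.List.Relation.Unary.All using (All)
open import Data.List.Relation.Unary.Unique.Propositional using (Unique)
open import Data.Product using (Σ; ∃; _×_; _,_)
open import Data.Sum using (_⊎_)
open import Function using (_∘_)
open import Relation.Binary.PropositionalEquality using (_≡_; _≢_)
open import Function.Bundles using (_⇔_)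

-- A finite graph with vertices labelled by natural numbers, given by an
-- explicit vertex list and an (undirected) edge list, together with three
-- distinguished "outmost" vertices A, B, C.
record Gr : Set where
  field
    bound : ℕ                -- all labels are < bound
    verts : List ℕ
    edges : List (ℕ × ℕ)
    A B C : ℕ
open Gr public

triangle : Gr
triangle = record { bound = 3 ; verts = 0 ∷ 1 ∷ 2 ∷ []
                  ; edges = (0 , 1) ∷ (1 , 2) ∷ (0 , 2) ∷ []
                  ; A = 0 ; B = 1 ; C = 2 }

-- S_{g+1} from S_g: three copies; copy θ is embedded by f θ.
-- copy 1: identity; copy 2: A ↦ B^1 (identifies B^1 = A^2), else v ↦ m + v;
-- copy 3: A ↦ C^1 (identifies C^1 = A^3), B ↦ m + C (= C^2, identifies C^2 = B^3),
-- else v ↦ 2m + v.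
glue : Gr → Gr
glue G = record
  { bound = 3 * m
  ; verts = verts G ++ map f2 (filterᵇ (λ v → not (v ≡ᵇ A G)) (verts G))
                    ++ map f3 (filterᵇ (λ v → not (v ≡ᵇ A G) ∧ not (v ≡ᵇ B G)) (verts G))
  ; edges = edges G ++ map (λ { (u , v) → (f2 u , f2 v) }) (edges G)
                    ++ map (λ { (u , v) → (f3 u , f3 v) }) (edges G)
  ; A = A G
  ; B = f2 (B G)
  ; C = f3 (C G)
  }
  where
    m = bound G
    f2 : ℕ → ℕ
    f2 v = if v ≡ᵇ A G then B G else m + v
    f3 : ℕ → ℕ
    f3 v = if v ≡ᵇ A G then C G else (if v ≡ᵇ B G then m + C G else 2 * m + v)

-- Sierpinski graph S_g (meaningful for g ≥ 1; S 0 is set equal to S 1).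
Sier' : ℕ → Gr
Sier' zero = triangle
Sier' (suc k) = glue (Sier' k)

Sier : ℕ → Gr
Sier g = Sier' (g ∸ 1)

adj : Gr → ℕ → ℕ → Bool
adj G u v = any (λ { (x , y) → ((x ≡ᵇ u) ∧ (y ≡ᵇ v)) ∨ ((x ≡ᵇ v) ∧ (y ≡ᵇ u)) }) (edges G)

memb : ℕ → List ℕ → Bool
memb x xs = any (x ≡ᵇ_) xs

nbhd : Gr → ℕ → List ℕ
nbhd G v = filterᵇ (λ u → (u ≡ᵇ v) ∨ adj G v u) (verts G)

P0 : Gr → List ℕ → ℕ → Bool
P0 G D x = memb x (verts G) ∧ any (λ d → memb x (nbhd G d)) D

Pstep : Gr → (ℕ → Bool) → ℕ → Bool
Pstep G P x = any (λ v → P v ∧ (length (filterᵇ (not ∘ P) (nbhd G v)) ≤ᵇ 1)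
                             ∧ memb x (nbhd G v)) (verts G)

Pi : Gr → List ℕ → ℕ → ℕ → Bool
Pi G D zero = P0 G D
Pi G D (suc i) = Pstep G (Pi G D i)

InPinf : Gr → List ℕ → ℕ → Set
InPinf G D x = ∃ λ i → Pi G D i x ≡ true

IsOut : Gr → ℕ → Set
IsOut G z = (z ≡ A G) ⊎ (z ≡ B G) ⊎ (z ≡ C G)

Consec : List ℕ → ℕ → ℕ → Set
Consec [] u v = ⊥
Consec (_ ∷ []) u v = ⊥
Consec (a ∷ b ∷ rest) u v = ((u ≡ a) × (v ≡ b)) ⊎ Consec (b ∷ rest) u v

RemainderIsPath : Gr → List ℕ → List ℕ → ℕ → ℕ → Set
RemainderIsPath G S p x y =
  Unique p ×
  (∀ u → u ∈ p ⇔ ((u ∈ verts G) × (InPinf G S u → ⊥))) ×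
  (Σ (List ℕ) λ mid → p ≡ x ∷ (mid ∷ʳ y)) ×
  (∀ u v → u ∈ p → v ∈ p → (adj G u v ≡ true) ⇔ (Consec p u v ⊎ Consec p v u))

SizedSubset : ℕ → List ℕ → Set
SizedSubset g S = Unique S × All (_∈ verts (Sier g)) S
                  × length S ≡ (3 ^ (g ∸ 2) + 1) / 2

Condition2 : ℕ → List ℕ → Set
Condition2 g S =
  SizedSubset g S ×
  Σ (List ℕ) λ p → Σ ℕ λ x → Σ ℕ λ y →
    IsOut (Sier g) x × IsOut (Sier g) y × x ≢ y ×
    RemainderIsPath (Sier g) S p x y ×
    (∀ z → IsOut (Sier g) z → z ∉ p → z ∈ S)

Condition3 : ℕ → List ℕ → Set
Condition3 g S =
  SizedSubset g S ×
  (∀ v → v ∈ verts (Sier g) → InPinf (Sier g) S v) ×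
  (∀ z → IsOut (Sier g) z → z ∉ S)

-- Call (S, p) a remainder pair of a graph if p is an induced path, N[S] is exactly the set of
-- vertices off p, and no vertex off p has exactly one neighbour on p. Then no vertex can ever
-- force a vertex of p, so P^∞(S) is the complement of p. In 𝒮₂ every corner X gives such a pair
-- ({X}, the path through the two other corners). Three pairs of 𝒮_g, one per copy and chosen so
-- that each glued corner lies on both paths or in both seed sets, combine into a pair of 𝒮_{g+1}
-- whose path crosses all three copies, and the seed sizes follow s ↦ 3s − 1, giving (3^{g-2}+1)/2.
-- This is Θ¹ (the construction works for every g ≥ 2). For Θ² replace the corner A = 0 of Θ¹ by
-- its neighbour 1: N[A] ⊆ N[1], so N[Θ²] still covers everything off the path, and it also
-- contains the adjacent path vertices 4 and 5, from which the path is forced in both directions.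
module Submission where

open import Defs
open import Data.Bool using (Bool; true; false; T; not; _∧_; _∨_; if_then_else_)
open import Data.Bool.Properties using (T-≡; T-not-≡; T-∧; T-∨; T?)
open import Data.Empty using (⊥; ⊥-elim)
open import Data.List using (List; []; _∷_; _++_; map; filterᵇ; length; _∷ʳ_; reverse)
open import Data.List.Properties
  using (filter-none; ++-assoc; unfold-reverse; reverse-++; reverse-involutive; map-++; map-id; length-++; length-map)
open import Data.List.Membership.Propositional using (_∈_; _∉_; find; lose)
open import Data.List.Membership.Propositional.Properties using (∈-filter⁻; ∈-filter⁺; ∈-++⁺ˡ; ∈-++⁺ʳ; ∈-++⁻; ∈-map⁺; ∈-map⁻)
open import Data.List.Relation.Unary.All as All using (All; []; _∷_; all?)
import Data.List.Relation.Unary.All.Properties as AllP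
open import Data.List.Relation.Unary.AllPairs as AllPairs using ([]; _∷_)
open import Data.List.Relation.Unary.Any as Any using (Any; here; there; any?)
open import Data.List.Relation.Unary.Any.Properties using (any⁺; any⁻; Any-⊎⁺; Any-⊎⁻; reverse⁺; reverse⁻)
open import Data.List.Relation.Unary.Unique.Propositional using (Unique)
open import Data.List.Relation.Unary.Unique.Propositional.Properties as Unique using (Unique[x∷xs]⇒x∉xs)
open import Data.List.Relation.Binary.Disjoint.Propositional using (Disjoint)
open import Data.List.Relation.Binary.Permutation.Propositional using (↭-sym; ↭⇒↭ₛ)
open import Data.List.Relation.Binary.Permutation.Propositional.Properties using (↭-reverse)
open import Data.List.Relation.Binary.Permutation.Setoid.Properties using (Unique-resp-↭)
open import Data.Nat using (ℕ; zero; suc; _+_; _*_; _^_; _≤_; _<_; _≥_; _≡ᵇ_; _≟_; _<?_; z≤n; s≤s)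
open import Data.Nat.Properties
  using (≡ᵇ⇒≡; ≡⇒≡ᵇ; ≤ᵇ⇒≤; ≤⇒≤ᵇ; m≤n⇒m≤1+n; ≤-trans; <⇒≱; +-cancelˡ-≡; m≤m+n; <⇒≢; <-≤-trans; +-monoʳ-<; +-monoʳ-≤; +-identityʳ; +-assoc)
open import Data.Nat.DivMod using (_/_; m*n/n≡m)
open import Data.Nat.Tactic.RingSolver using (solve-∀)
open import Data.List.Membership.DecPropositional _≟_ using (_∈?_)
open import Data.List.Relation.Unary.Unique.DecPropositional _≟_ using (unique?)
open import Data.Product using (Σ; Σ-syntax; ∃-syntax; _×_; _,_; proj₁; proj₂; swap)
import Data.Product as Product
open import Data.Sum using (_⊎_; inj₁; inj₂)
import Data.Sum as Sum
open import Data.Unit using (tt)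
open import Function using (_∘_; const; _⇔_; mk⇔; Equivalence)
open import Function.Construct.Composition using (_⇔-∘_)
open import Function.Construct.Identity using (⇔-id)
open import Function.Construct.Symmetry using (⇔-sym)
open import Relation.Binary.PropositionalEquality
  using (_≡_; _≢_; refl; sym; trans; cong; cong₂; subst; setoid; module ≡-Reasoning)
open import Relation.Nullary using (¬_; Dec; yes; no; ¬?)
open import Relation.Nullary.Decidable using (True; _×-dec_; _⊎-dec_; _→-dec_; toWitness)

≡ᵇ-refl : ∀ x → T (x ≡ᵇ x)
≡ᵇ-refl x = ≡⇒≡ᵇ x x refl

T-not⁺ : ∀ {b} → ¬ T b → T (not b)
T-not⁺ {false} _ = tt
T-not⁺ {true} ¬t = ¬t tt

T-not⁻ : ∀ {b} → T (not b) → ¬ T b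
T-not⁻ {false} _ ()

≡ᵇ-diag : ∀ x → (x ≡ᵇ x) ≡ true
≡ᵇ-diag x = Equivalence.to T-≡ (≡ᵇ-refl x)

≢⇒T-not-≡ᵇ : ∀ {x y} → x ≢ y → T (not (x ≡ᵇ y))
≢⇒T-not-≡ᵇ {x} {y} x≢y = T-not⁺ (x≢y ∘ ≡ᵇ⇒≡ x y)

T-not-≡ᵇ⇒≢ : ∀ {x y} → T (not (x ≡ᵇ y)) → x ≢ y
T-not-≡ᵇ⇒≢ {x} {y} t x≡y = T-not⁻ t (≡⇒≡ᵇ x y x≡y)

≢⇒≡ᵇ-false : ∀ {x y} → x ≢ y → (x ≡ᵇ y) ≡ false
≢⇒≡ᵇ-false = Equivalence.to T-not-≡ ∘ ≢⇒T-not-≡ᵇ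

∈⇒memb : ∀ {x xs} → x ∈ xs → T (memb x xs)
∈⇒memb {x} = any⁺ _ ∘ Any.map λ { refl → ≡ᵇ-refl x }

memb⇒∈ : ∀ {x xs} → T (memb x xs) → x ∈ xs
memb⇒∈ {x} {xs} = Any.map (≡ᵇ⇒≡ x _) ∘ any⁻ _ xs

-- Neighbourhoods and propagation

Adj : Gr → ℕ → ℕ → Set
Adj G u v = T (adj G u v)

IsEdge : Gr → ℕ → ℕ → Set
IsEdge G u v = (u , v) ∈ edges G ⊎ (v , u) ∈ edges G

adj⇒edge : ∀ G {u v} → Adj G u v → IsEdge G u v
adj⇒edge G {u} {v} = Any-⊎⁻ ∘ Any.map matches ∘ any⁻ _ (edges G)
  where
    matches : ∀ {e} → T (((proj₁ e ≡ᵇ u) ∧ (proj₂ e ≡ᵇ v)) ∨ ((proj₁ e ≡ᵇ v) ∧ (proj₂ e ≡ᵇ u))) →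
              (u , v) ≡ e ⊎ (v , u) ≡ e
    matches {x , y} t with Equivalence.to T-∨ t
    ... | inj₁ xy = let (xu , yv) = Equivalence.to T-∧ xy in inj₁ (sym (cong₂ _,_ (≡ᵇ⇒≡ x u xu) (≡ᵇ⇒≡ y v yv)))
    ... | inj₂ xy = let (xv , yu) = Equivalence.to T-∧ xy in inj₂ (sym (cong₂ _,_ (≡ᵇ⇒≡ x v xv) (≡ᵇ⇒≡ y u yu)))

edge⇒adj : ∀ G {u v} → IsEdge G u v → Adj G u v
edge⇒adj G {u} {v} = any⁺ _ ∘ Any.map matched ∘ Any-⊎⁺
  where
    matched : ∀ {e} → (u , v) ≡ e ⊎ (v , u) ≡ e →
              T (((proj₁ e ≡ᵇ u) ∧ (proj₂ e ≡ᵇ v)) ∨ ((proj₁ e ≡ᵇ v) ∧ (proj₂ e ≡ᵇ u)))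
    matched (inj₁ refl) = Equivalence.from T-∨ (inj₁ (Equivalence.from T-∧ (≡ᵇ-refl u , ≡ᵇ-refl v)))
    matched (inj₂ refl) = Equivalence.from T-∨ (inj₂ (Equivalence.from T-∧ (≡ᵇ-refl v , ≡ᵇ-refl u)))

adj-sym : ∀ G {u v} → Adj G u v → Adj G v u
adj-sym G = edge⇒adj G ∘ Sum.swap ∘ adj⇒edge G

Neighbour : Gr → ℕ → ℕ → Set
Neighbour G v u = u ≡ v ⊎ Adj G v u

∈-nbhd⁻ : ∀ G v {u} → u ∈ nbhd G v → u ∈ verts G × Neighbour G v u
∈-nbhd⁻ G v {u} m with ∈-filter⁻ (T? ∘ λ u → (u ≡ᵇ v) ∨ adj G v u) m
... | mu , t = mu , Sum.map₁ (≡ᵇ⇒≡ u v) (Equivalence.to T-∨ t)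

∈-nbhd⁺ : ∀ G v {u} → u ∈ verts G → Neighbour G v u → u ∈ nbhd G v
∈-nbhd⁺ G v {u} mu nb =
  ∈-filter⁺ (T? ∘ λ u → (u ≡ᵇ v) ∨ adj G v u) mu (Equivalence.from T-∨ (Sum.map₁ (λ { refl → ≡ᵇ-refl u }) nb))

P0⁻ : ∀ G D {u} → T (P0 G D u) → ∃[ d ] d ∈ D × u ∈ nbhd G d
P0⁻ G D {u} t = find (Any.map memb⇒∈ (any⁻ _ D (proj₂ (Equivalence.to T-∧ t))))

P0⁺ : ∀ G D {u d} → d ∈ D → u ∈ nbhd G d → T (P0 G D u)
P0⁺ G D {u} md mu = Equivalence.from T-∧
  (∈⇒memb (proj₁ (∈-nbhd⁻ G _ mu)) , any⁺ _ (lose md (∈⇒memb mu)))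

Unobserved : Gr → (ℕ → Bool) → ℕ → List ℕ
Unobserved G P v = filterᵇ (not ∘ P) (nbhd G v)

CanForce : Gr → (ℕ → Bool) → ℕ → Set
CanForce G P v = v ∈ verts G × T (P v) × length (Unobserved G P v) ≤ 1

Pstep⁻ : ∀ G P {u} → T (Pstep G P u) → ∃[ v ] CanForce G P v × u ∈ nbhd G v
Pstep⁻ G P {u} t with find (any⁻ _ (verts G) t)
... | v , mv , tv with Equivalence.to T-∧ tv
... | pv , rest with Equivalence.to T-∧ rest
... | few , mu = v , (mv , pv , ≤ᵇ⇒≤ _ 1 few) , memb⇒∈ mu

Pstep⁺ : ∀ G P {u v} → CanForce G P v → u ∈ nbhd G v → T (Pstep G P u)
Pstep⁺ G P (mv , pv , few) mu =
  any⁺ _ (lose mv (Equivalence.from T-∧ (pv , Equivalence.from T-∧ (≤⇒≤ᵇ few , ∈⇒memb mu))))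

length-filterᵇ-mono : ∀ {A : Set} (p q : A → Bool) → (∀ {x} → T (q x) → T (p x)) →
                      ∀ xs → length (filterᵇ q xs) ≤ length (filterᵇ p xs)
length-filterᵇ-mono p q q⇒p [] = z≤n
length-filterᵇ-mono p q q⇒p (x ∷ xs) with q x in qx | p x in px
... | true  | true  = s≤s (length-filterᵇ-mono p q q⇒p xs)
... | true  | false = ⊥-elim (subst T px (q⇒p (subst T (sym qx) tt)))
... | false | true  = m≤n⇒m≤1+n (length-filterᵇ-mono p q q⇒p xs)
... | false | false = length-filterᵇ-mono p q q⇒p xs

length-≤1 : ∀ {A : Set} {u : A} {ys} → Unique ys → All (_≡ u) ys → length ys ≤ 1
length-≤1 [] [] = z≤n
length-≤1 (_ ∷ []) (_ ∷ []) = s≤s z≤n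
length-≤1 ((x≢y ∷ _) ∷ _) (refl ∷ refl ∷ _) = ⊥-elim (x≢y refl)

length-≥2 : ∀ {A : Set} {u v : A} {ys} → u ∈ ys → v ∈ ys → u ≢ v → 2 ≤ length ys
length-≥2 {ys = _ ∷ []} (here refl) (here refl) u≢v = ⊥-elim (u≢v refl)
length-≥2 {ys = _ ∷ _ ∷ _} _ _ _ = s≤s (s≤s z≤n)

CanForce-mono : ∀ G {P Q : ℕ → Bool} → (∀ {x} → T (P x) → T (Q x)) → ∀ {v} → CanForce G P v → CanForce G Q v
CanForce-mono G {P} {Q} P⇒Q (mv , pv , few) =
  mv , P⇒Q pv , ≤-trans (length-filterᵇ-mono (not ∘ P) (not ∘ Q) ¬Q⇒¬P (nbhd G _)) few
  where
    ¬Q⇒¬P : ∀ {x} → T (not (Q x)) → T (not (P x))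
    ¬Q⇒¬P ¬q = T-not⁺ (T-not⁻ ¬q ∘ P⇒Q)

CanForce-intro : ∀ G (P : ℕ → Bool) {u v} → Unique (verts G) → v ∈ verts G → T (P v) →
                 (∀ {w} → w ∈ nbhd G v → ¬ T (P w) → w ≡ u) → CanForce G P v
CanForce-intro G P {u} {v} uV mv pv onlyU = mv , pv , length-≤1 unique (All.tabulate isU)
  where
    unique : Unique (Unobserved G P v)
    unique = Unique.filter⁺ (T? ∘ not ∘ P) (Unique.filter⁺ (T? ∘ λ w → (w ≡ᵇ v) ∨ adj G v w) uV)
    isU : ∀ {w} → w ∈ Unobserved G P v → w ≡ u
    isU m with ∈-filter⁻ (T? ∘ not ∘ P) m
    ... | mw , ¬pw = onlyU mw (T-not⁻ ¬pw)

¬CanForce-two : ∀ G (P : ℕ → Bool) {u u' v} → CanForce G P v → u ∈ nbhd G v → u' ∈ nbhd G v → u ≢ u' →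
                ¬ T (P u) → ¬ T (P u') → ⊥
¬CanForce-two G P (_ , _ , few) mu mu' u≢u' ¬pu ¬pu' =
  <⇒≱ (length-≥2 (unobserved mu ¬pu) (unobserved mu' ¬pu') u≢u') few
  where
    unobserved : ∀ {w} → w ∈ nbhd G _ → ¬ T (P w) → w ∈ Unobserved G P _
    unobserved mw ¬pw = ∈-filter⁺ (T? ∘ not ∘ P) mw (T-not⁺ ¬pw)

Pi-suc : ∀ G D → All (_∈ verts G) D → ∀ n {u} → T (Pi G D n u) → T (Pi G D (suc n) u)
Pi-suc G D D⊆V zero {u} t with P0⁻ G D t
... | d , md , mu = Pstep⁺ G (P0 G D) {u} (d∈V , d-observed , nothing-unobserved) mu
  where
    d∈V : d ∈ verts G
    d∈V = All.lookup D⊆V md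
    d-observed : T (P0 G D d)
    d-observed = P0⁺ G D {d} md (∈-nbhd⁺ G d {d} d∈V (inj₁ refl))
    nothing-unobserved : length (Unobserved G (P0 G D) d) ≤ 1
    nothing-unobserved = subst (λ l → length l ≤ 1)
      (sym (filter-none (T? ∘ not ∘ P0 G D) (All.tabulate λ mw unobs → T-not⁻ unobs (P0⁺ G D md mw))))
      z≤n
Pi-suc G D D⊆V (suc n) {u} t with Pstep⁻ G (Pi G D n) t
... | v , can , mu = Pstep⁺ G (Pi G D (suc n)) {u} (CanForce-mono G (Pi-suc G D D⊆V n) can) mu

Pi-lift : ∀ G D → All (_∈ verts G) D → ∀ n {u} → T (Pi G D 0 u) → T (Pi G D n u)
Pi-lift G D D⊆V zero t = t
Pi-lift G D D⊆V (suc n) {u} t = Pi-suc G D D⊆V n (Pi-lift G D D⊆V n {u} t)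

-- Induced paths

Unique-reverse : ∀ {xs : List ℕ} → Unique xs → Unique (reverse xs)
Unique-reverse {xs} = Unique-resp-↭ (setoid ℕ) (↭⇒↭ₛ (↭-sym (↭-reverse xs)))

Consec-∈ : ∀ q {u v} → Consec q u v → u ∈ q × v ∈ q
Consec-∈ (a ∷ b ∷ r) (inj₁ (refl , refl)) = here refl , there (here refl)
Consec-∈ (a ∷ b ∷ r) (inj₂ c) = Product.map there there (Consec-∈ (b ∷ r) c)

Consec-∷ : ∀ x q {u v} → Consec q u v → Consec (x ∷ q) u v
Consec-∷ x (a ∷ b ∷ r) c = inj₂ c

Consec-++ʳ : ∀ xs {ys u v} → Consec ys u v → Consec (xs ++ ys) u v
Consec-++ʳ [] c = c
Consec-++ʳ (x ∷ xs) c = Consec-∷ x (xs ++ _) (Consec-++ʳ xs c)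

Consec-++ˡ : ∀ xs ys {u v} → Consec xs u v → Consec (xs ++ ys) u v
Consec-++ˡ (a ∷ b ∷ r) ys (inj₁ e) = inj₁ e
Consec-++ˡ (a ∷ b ∷ r) ys (inj₂ c) = inj₂ (Consec-++ˡ (b ∷ r) ys c)

Consec-split : ∀ q {u v} → Consec q u v → ∃[ pre ] ∃[ post ] q ≡ pre ++ u ∷ v ∷ post
Consec-split (a ∷ b ∷ r) (inj₁ (refl , refl)) = [] , r , refl
Consec-split (a ∷ b ∷ r) (inj₂ c) with Consec-split (b ∷ r) c
... | pre , post , eq = a ∷ pre , post , cong (a ∷_) eq

Consec-middle : ∀ pre post u v → Consec (pre ++ u ∷ v ∷ post) u v
Consec-middle pre post u v = Consec-++ʳ pre (inj₁ (refl , refl))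

reverse-middle : ∀ pre post (u v : ℕ) → reverse (pre ++ u ∷ v ∷ post) ≡ reverse post ++ v ∷ u ∷ reverse pre
reverse-middle pre post u v = begin
  reverse (pre ++ u ∷ v ∷ post)          ≡⟨ reverse-++ pre (u ∷ v ∷ post) ⟩
  reverse (u ∷ v ∷ post) ++ reverse pre  ≡⟨ cong (_++ reverse pre) (unfold-reverse u (v ∷ post)) ⟩
  (reverse (v ∷ post) ∷ʳ u) ++ reverse pre ≡⟨ cong (λ l → (l ∷ʳ u) ++ reverse pre) (unfold-reverse v post) ⟩
  ((reverse post ∷ʳ v) ∷ʳ u) ++ reverse pre ≡⟨ cong (_++ reverse pre) (++-assoc (reverse post) (v ∷ []) (u ∷ [])) ⟩
  (reverse post ++ v ∷ u ∷ []) ++ reverse pre ≡⟨ ++-assoc (reverse post) (v ∷ u ∷ []) (reverse pre) ⟩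
  reverse post ++ v ∷ u ∷ reverse pre    ∎
  where open ≡-Reasoning

Consec-reverse : ∀ q {u v} → Consec q u v → Consec (reverse q) v u
Consec-reverse q {u} {v} c with Consec-split q c
... | pre , post , refl = subst (λ l → Consec l v u) (sym (reverse-middle pre post u v)) (Consec-middle (reverse post) (reverse pre) v u)

Consec-reverse⁻ : ∀ q {u v} → Consec (reverse q) u v → Consec q v u
Consec-reverse⁻ q c = subst (λ l → Consec l _ _) (reverse-involutive q) (Consec-reverse (reverse q) c)

Consec-map : ∀ (f : ℕ → ℕ) q {u v} → Consec q u v → Consec (map f q) (f u) (f v)
Consec-map f (a ∷ b ∷ r) (inj₁ (refl , refl)) = inj₁ (refl , refl)
Consec-map f (a ∷ b ∷ r) (inj₂ c) = inj₂ (Consec-map f (b ∷ r) c)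

Consec-map⁻ : ∀ (f : ℕ → ℕ) q {u' v'} → Consec (map f q) u' v' → ∃[ u ] ∃[ v ] Consec q u v × u' ≡ f u × v' ≡ f v
Consec-map⁻ f (a ∷ b ∷ r) (inj₁ (refl , refl)) = a , b , inj₁ (refl , refl) , refl , refl
Consec-map⁻ f (a ∷ b ∷ r) (inj₂ c) with Consec-map⁻ f (b ∷ r) c
... | u , v , c' , refl , refl = u , v , inj₂ c' , refl , refl

Consec-join⁻ : ∀ xs s ys {u v} → Consec (xs ++ s ∷ ys) u v → Consec (xs ∷ʳ s) u v ⊎ Consec (s ∷ ys) u v
Consec-join⁻ [] s ys c = inj₂ c
Consec-join⁻ (x ∷ []) s ys (inj₁ e) = inj₁ (inj₁ e)
Consec-join⁻ (x ∷ []) s ys (inj₂ c) = inj₂ c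
Consec-join⁻ (x ∷ x' ∷ xs) s ys (inj₁ e) = inj₁ (inj₁ e)
Consec-join⁻ (x ∷ x' ∷ xs) s ys (inj₂ c) = Sum.map₁ inj₂ (Consec-join⁻ (x' ∷ xs) s ys c)

Consec-join⁺ˡ : ∀ xs s ys {u v} → Consec (xs ∷ʳ s) u v → Consec (xs ++ s ∷ ys) u v
Consec-join⁺ˡ xs s ys c = subst (λ l → Consec l _ _) (++-assoc xs (s ∷ []) ys) (Consec-++ˡ (xs ∷ʳ s) ys c)

Consec-functional : ∀ q {u v w} → Unique q → Consec q u v → Consec q u w → v ≡ w
Consec-functional (x ∷ y ∷ r) _ (inj₁ (refl , refl)) (inj₁ (refl , refl)) = refl
Consec-functional (x ∷ y ∷ r) uq (inj₁ (refl , refl)) (inj₂ c) = ⊥-elim (Unique[x∷xs]⇒x∉xs uq (proj₁ (Consec-∈ (y ∷ r) c)))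
Consec-functional (x ∷ y ∷ r) uq (inj₂ c) (inj₁ (refl , refl)) = ⊥-elim (Unique[x∷xs]⇒x∉xs uq (proj₁ (Consec-∈ (y ∷ r) c)))
Consec-functional (x ∷ y ∷ r) (_ ∷ uq) (inj₂ c) (inj₂ c') = Consec-functional (y ∷ r) uq c c'

Consec-injective : ∀ q {u v w} → Unique q → Consec q v u → Consec q w u → v ≡ w
Consec-injective q uq c c' = Consec-functional (reverse q) (Unique-reverse uq) (Consec-reverse q c) (Consec-reverse q c')

Unique-++⁻ˡ : ∀ xs {ys : List ℕ} → Unique (xs ++ ys) → Unique xs
Unique-++⁻ˡ [] _ = []
Unique-++⁻ˡ (x ∷ xs) (x∉ ∷ uq) = AllP.++⁻ˡ xs x∉ ∷ Unique-++⁻ˡ xs uq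

Unique-++-disjoint : ∀ xs {ys : List ℕ} → Unique (xs ++ ys) → ∀ {z} → z ∈ xs → z ∈ ys → ⊥
Unique-++-disjoint (x ∷ xs) (x∉ ∷ _) (here refl) m = All.lookup x∉ (∈-++⁺ʳ xs m) refl
Unique-++-disjoint (x ∷ xs) (_ ∷ uq) (there m₁) m₂ = Unique-++-disjoint xs uq m₁ m₂

Linked : List ℕ → ℕ → ℕ → Set
Linked q u v = Consec q u v ⊎ Consec q v u

InducedPath : Gr → List ℕ → Set
InducedPath G q = Unique q × (∀ u v → u ∈ q → v ∈ q → Adj G u v ⇔ Linked q u v)

InducedPath-reverse : ∀ G q → InducedPath G q → InducedPath G (reverse q)
InducedPath-reverse G q (uq , h) = Unique-reverse uq , λ u v mu mv →
  let e = h u v (reverse⁻ mu) (reverse⁻ mv) in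
  mk⇔ (Sum.swap ∘ Sum.map (Consec-reverse q) (Consec-reverse q) ∘ Equivalence.to e)
      (Equivalence.from e ∘ Sum.swap ∘ Sum.map (Consec-reverse⁻ q) (Consec-reverse⁻ q))

InducedPath-map : ∀ G H (f : ℕ → ℕ) → (∀ {x y} → f x ≡ f y → x ≡ y) → ∀ q →
                  (∀ {a b} → a ∈ q → b ∈ q → Adj H (f a) (f b) ⇔ Adj G a b) →
                  InducedPath G q → InducedPath H (map f q)
InducedPath-map G H f f-inj q adj-f (uq , h) = Unique.map⁺ f-inj uq , λ u v mu mv → image (∈-map⁻ f mu) (∈-map⁻ f mv)
  where
    unmap : ∀ {a b} → Consec (map f q) (f a) (f b) → Consec q a b
    unmap c with Consec-map⁻ f q c
    ... | _ , _ , c' , fa≡ , fb≡ rewrite f-inj fa≡ | f-inj fb≡ = c'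
    linked-map : ∀ a b → Linked q a b ⇔ Linked (map f q) (f a) (f b)
    linked-map a b = mk⇔ (Sum.map (Consec-map f q) (Consec-map f q)) (Sum.map unmap unmap)
    image : ∀ {u v} → ∃[ a ] a ∈ q × u ≡ f a → ∃[ b ] b ∈ q × v ≡ f b → Adj H u v ⇔ Linked (map f q) u v
    image (a , ma , refl) (b , mb , refl) = linked-map a b ⇔-∘ (h a b ma mb ⇔-∘ adj-f ma mb)

InducedPath-join : ∀ G xs s ys → InducedPath G (xs ∷ʳ s) → InducedPath G (s ∷ ys) →
                   (∀ {u} → u ∈ xs ∷ʳ s → u ∈ s ∷ ys → u ≡ s) →
                   (∀ {u v} → u ∈ xs ∷ʳ s → v ∈ s ∷ ys → u ≢ s → v ≢ s → ¬ Adj G u v) →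
                   InducedPath G (xs ++ s ∷ ys)
InducedPath-join G xs s ys (uq₁ , h₁) (uq₂ , h₂) meet cross =
  Unique.++⁺ (Unique-++⁻ˡ xs uq₁) uq₂ disjoint , λ u v mu mv → mk⇔ (forward (side mu) (side mv)) backward
  where
    q : List ℕ
    q = xs ++ s ∷ ys
    disjoint : ∀ {z} → z ∈ xs × z ∈ s ∷ ys → ⊥
    disjoint (m₁ , m₂) with meet (∈-++⁺ˡ m₁) m₂
    ... | refl = Unique-++-disjoint xs uq₁ m₁ (here refl)
    side : ∀ {u} → u ∈ q → u ∈ xs ∷ʳ s ⊎ u ∈ s ∷ ys
    side m = Sum.map₁ ∈-++⁺ˡ (∈-++⁻ xs m)
    linked₁ : ∀ {u v} → Linked (xs ∷ʳ s) u v → Linked q u v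
    linked₁ = Sum.map (Consec-join⁺ˡ xs s ys) (Consec-join⁺ˡ xs s ys)
    linked₂ : ∀ {u v} → Linked (s ∷ ys) u v → Linked q u v
    linked₂ = Sum.map (Consec-++ʳ xs) (Consec-++ʳ xs)
    mixed : ∀ {u v} → u ∈ xs ∷ʳ s → v ∈ s ∷ ys → Adj G u v → Linked q u v
    mixed {u} {v} mu mv a with u ≟ s | v ≟ s
    ... | yes refl | _ = linked₂ (Equivalence.to (h₂ u v (here refl) mv) a)
    ... | no _ | yes refl = linked₁ (Equivalence.to (h₁ u v mu (∈-++⁺ʳ xs (here refl))) a)
    ... | no u≢s | no v≢s = ⊥-elim (cross mu mv u≢s v≢s a)
    forward : ∀ {u v} → u ∈ xs ∷ʳ s ⊎ u ∈ s ∷ ys → v ∈ xs ∷ʳ s ⊎ v ∈ s ∷ ys → Adj G u v → Linked q u v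
    forward (inj₁ mu) (inj₁ mv) = linked₁ ∘ Equivalence.to (h₁ _ _ mu mv)
    forward (inj₂ mu) (inj₂ mv) = linked₂ ∘ Equivalence.to (h₂ _ _ mu mv)
    forward (inj₁ mu) (inj₂ mv) = mixed mu mv
    forward (inj₂ mu) (inj₁ mv) = Sum.swap ∘ mixed mv mu ∘ adj-sym G
    consec : ∀ {u v} → Consec q u v → Adj G u v
    consec c with Consec-join⁻ xs s ys c
    ... | inj₁ c₁ = Equivalence.from (h₁ _ _ (proj₁ (Consec-∈ _ c₁)) (proj₂ (Consec-∈ _ c₁))) (inj₁ c₁)
    ... | inj₂ c₂ = Equivalence.from (h₂ _ _ (proj₁ (Consec-∈ _ c₂)) (proj₂ (Consec-∈ _ c₂))) (inj₁ c₂)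
    backward : ∀ {u v} → Linked q u v → Adj G u v
    backward (inj₁ c) = consec c
    backward (inj₂ c) = adj-sym G (consec c)

Disjoint-++ʳ : ∀ {L M N : List ℕ} → Disjoint L M → Disjoint L N → Disjoint L (M ++ N)
Disjoint-++ʳ {M = M} L∩M L∩N (mL , mMN) =
  Sum.[ (λ mM → L∩M (mL , mM)) , (λ mN → L∩N (mL , mN)) ] (∈-++⁻ M mMN)

Observed : Gr → List ℕ → ℕ → Set
Observed G D u = ∃[ n ] T (Pi G D n u)

module _ {G : Gr} {D q : List ℕ} (V-unique : Unique (verts G)) (D⊆V : All (_∈ verts G) D)
         (path : InducedPath G q) (q⊆V : ∀ {u} → u ∈ q → u ∈ verts G)
         (off-path : ∀ {w} → w ∈ verts G → w ∉ q → T (Pi G D 0 w)) where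

  private
    q-unique : Unique q
    q-unique = proj₁ path

  -- b forces its successor c: q is induced and everything off q is observed, so c is the only
  -- neighbour of b that may still be unobserved.
  observe-forward : ∀ post pre {a b} n → q ≡ pre ++ a ∷ b ∷ post → T (Pi G D n a) → T (Pi G D n b) →
                    ∀ {u} → u ∈ post → Observed G D u
  observe-forward (c ∷ post) pre {a} {b} n q≡ pa pb = observe
    where
      q≡' : q ≡ (pre ∷ʳ a) ++ b ∷ c ∷ post
      q≡' = trans q≡ (sym (++-assoc pre (a ∷ []) (b ∷ c ∷ post)))
      ab : Consec q a b
      ab = subst (λ l → Consec l a b) (sym q≡) (Consec-middle pre (c ∷ post) a b)
      bc : Consec q b c
      bc = subst (λ l → Consec l b c) (sym q≡') (Consec-middle (pre ∷ʳ a) post b c)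
      b∈q : b ∈ q
      b∈q = proj₁ (Consec-∈ q bc)
      c∈q : c ∈ q
      c∈q = proj₂ (Consec-∈ q bc)
      only-c : ∀ {w} → w ∈ nbhd G b → ¬ T (Pi G D n w) → w ≡ c
      only-c mw ¬pw with ∈-nbhd⁻ G b mw
      ... | _ , inj₁ refl = ⊥-elim (¬pw pb)
      ... | w∈V , inj₂ bw with _ ∈? q
      ... | no w∉q = ⊥-elim (¬pw (Pi-lift G D D⊆V n (off-path w∈V w∉q)))
      ... | yes w∈q with Equivalence.to (proj₂ path b _ b∈q w∈q) bw
      ... | inj₁ bw' = Consec-functional q q-unique bw' bc
      ... | inj₂ wb = ⊥-elim (¬pw (subst (T ∘ Pi G D n) (sym (Consec-injective q q-unique wb ab)) pa))
      pc : T (Pi G D (suc n) c)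
      pc = Pstep⁺ G (Pi G D n) {c} (CanForce-intro G (Pi G D n) V-unique (q⊆V b∈q) pb only-c)
             (∈-nbhd⁺ G b (q⊆V c∈q) (inj₂ (Equivalence.from (proj₂ path b c b∈q c∈q) (inj₁ bc))))
      observe : ∀ {u} → u ∈ c ∷ post → Observed G D u
      observe (here refl) = suc n , pc
      observe (there mu) = observe-forward post (pre ∷ʳ a) (suc n) q≡' (Pi-suc G D D⊆V n pb) pc mu

observe-path : ∀ {G : Gr} {D q : List ℕ} → Unique (verts G) → All (_∈ verts G) D →
               InducedPath G q → (∀ {u} → u ∈ q → u ∈ verts G) →
               (∀ {w} → w ∈ verts G → w ∉ q → T (Pi G D 0 w)) →
               ∀ {a b n} → Consec q a b → T (Pi G D n a) → T (Pi G D n b) → ∀ {u} → u ∈ q → Observed G D u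
observe-path {G} {q = q} V-unique D⊆V path q⊆V off-path {a} {b} {n} ab pa pb mu with Consec-split q ab
... | pre , post , q≡ with ∈-++⁻ pre (subst (_ ∈_) q≡ mu)
... | inj₂ (here refl) = n , pa
... | inj₂ (there (here refl)) = n , pb
... | inj₂ (there (there m)) = observe-forward V-unique D⊆V path q⊆V off-path post pre n q≡ pa pb m
... | inj₁ m = observe-forward V-unique D⊆V (InducedPath-reverse G q path) (q⊆V ∘ reverse⁻)
                (λ w∈V w∉rq → off-path w∈V (w∉rq ∘ reverse⁺)) (reverse pre) (reverse post) n
                (trans (cong reverse q≡) (reverse-middle pre post a b)) pb pa (reverse⁺ m)

-- Gluing three copies

data Copy : Set where
  c₁ c₂ c₃ : Copy

-- The embeddings of the second and third copy, exactly as f2 and f3 in the definition of glue.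
embed₂ : Gr → ℕ → ℕ
embed₂ G v = if v ≡ᵇ A G then B G else bound G + v

embed₃ : Gr → ℕ → ℕ
embed₃ G v = if v ≡ᵇ A G then C G else (if v ≡ᵇ B G then bound G + C G else 2 * bound G + v)

embed : Gr → Copy → ℕ → ℕ
embed G c₁ v = v
embed G c₂ v = embed₂ G v
embed G c₃ v = embed₃ G v

Glued : Gr → Copy → ℕ → Copy → ℕ → Set
Glued G c₁ a c₁ b = a ≡ b
Glued G c₂ a c₂ b = a ≡ b
Glued G c₃ a c₃ b = a ≡ b
Glued G c₁ a c₂ b = a ≡ B G × b ≡ A G
Glued G c₂ a c₁ b = a ≡ A G × b ≡ B G
Glued G c₁ a c₃ b = a ≡ C G × b ≡ A G
Glued G c₃ a c₁ b = a ≡ A G × b ≡ C G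
Glued G c₂ a c₃ b = a ≡ C G × b ≡ B G
Glued G c₃ a c₂ b = a ≡ B G × b ≡ C G

record WellFormed (G : Gr) : Set where
  field
    verts-unique : Unique (verts G)
    verts-bound  : ∀ {u} → u ∈ verts G → u < bound G
    A∈V : A G ∈ verts G
    B∈V : B G ∈ verts G
    C∈V : C G ∈ verts G
    A≢B : A G ≢ B G
    A≢C : A G ≢ C G
    B≢C : B G ≢ C G
    irreflexive : ∀ {u} → ¬ Adj G u u
    adj⇒∈V : ∀ {u v} → Adj G u v → u ∈ verts G
    ¬adj-AB : ¬ Adj G (A G) (B G)
    ¬adj-AC : ¬ Adj G (A G) (C G)
    ¬adj-BC : ¬ Adj G (B G) (C G)

_≟ᶜ_ : (θ θ' : Copy) → Dec (θ ≡ θ')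
c₁ ≟ᶜ c₁ = yes refl
c₂ ≟ᶜ c₂ = yes refl
c₃ ≟ᶜ c₃ = yes refl
c₁ ≟ᶜ c₂ = no λ ()
c₁ ≟ᶜ c₃ = no λ ()
c₂ ≟ᶜ c₁ = no λ ()
c₂ ≟ᶜ c₃ = no λ ()
c₃ ≟ᶜ c₁ = no λ ()
c₃ ≟ᶜ c₂ = no λ ()

<⇒≢+ : ∀ {x m} y → x < m → x ≢ m + y
<⇒≢+ {m = m} y x<m refl = <⇒≢ (<-≤-trans x<m (m≤m+n m y)) refl

module GlueProperties (G : Gr) (wf : WellFormed G) where
  open WellFormed wf

  m : ℕ
  m = bound G

  V : List ℕ
  V = verts G

  H : Gr
  H = glue G

  B<m : B G < m
  B<m = verts-bound B∈V

  C<m : C G < m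
  C<m = verts-bound C∈V

  embed₂-A : embed₂ G (A G) ≡ B G
  embed₂-A rewrite ≡ᵇ-diag (A G) = refl

  embed₂-other : ∀ {v} → v ≢ A G → embed₂ G v ≡ m + v
  embed₂-other v≢A rewrite ≢⇒≡ᵇ-false v≢A = refl

  embed₃-A : embed₃ G (A G) ≡ C G
  embed₃-A rewrite ≡ᵇ-diag (A G) = refl

  embed₃-B : embed₃ G (B G) ≡ m + C G
  embed₃-B rewrite ≢⇒≡ᵇ-false (A≢B ∘ sym) | ≡ᵇ-diag (B G) = refl

  embed₃-other : ∀ {v} → v ≢ A G → v ≢ B G → embed₃ G v ≡ m + (m + v)
  embed₃-other {v} v≢A v≢B rewrite ≢⇒≡ᵇ-false v≢A | ≢⇒≡ᵇ-false v≢B | +-identityʳ m = +-assoc m m v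

  embed₂-C : embed₂ G (C G) ≡ m + C G
  embed₂-C = embed₂-other (A≢C ∘ sym)

  ≢Aᵇ ≢ABᵇ : ℕ → Bool
  ≢Aᵇ v = not (v ≡ᵇ A G)
  ≢ABᵇ v = not (v ≡ᵇ A G) ∧ not (v ≡ᵇ B G)

  data View₂ (v : ℕ) : Set where
    at-A  : v ≡ A G → View₂ v
    off-A : v ≢ A G → View₂ v

  view₂ : ∀ v → View₂ v
  view₂ v with v ≟ A G
  ... | yes v≡A = at-A v≡A
  ... | no v≢A = off-A v≢A

  data View₃ (v : ℕ) : Set where
    at-A   : v ≡ A G → View₃ v
    at-B   : v ≡ B G → View₃ v
    off-AB : v ≢ A G → v ≢ B G → View₃ v

  view₃ : ∀ v → View₃ v
  view₃ v with v ≟ A G | v ≟ B G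
  ... | yes v≡A | _ = at-A v≡A
  ... | no _ | yes v≡B = at-B v≡B
  ... | no v≢A | no v≢B = off-AB v≢A v≢B

  -- Apart from the glued corners, copy θ uses the labels in [(θ−1)·m, θ·m).
  glued₁₂ : ∀ {a b} → a ∈ V → a ≡ embed₂ G b → Glued G c₁ a c₂ b
  glued₁₂ {a} {b} ma e with view₂ b
  ... | at-A refl = trans e embed₂-A , refl
  ... | off-A b≢A = ⊥-elim (<⇒≢+ b (verts-bound ma) (trans e (embed₂-other b≢A)))

  glued₁₃ : ∀ {a b} → a ∈ V → a ≡ embed₃ G b → Glued G c₁ a c₃ b
  glued₁₃ {a} {b} ma e with view₃ b
  ... | at-A refl = trans e embed₃-A , refl
  ... | at-B refl = ⊥-elim (<⇒≢+ (C G) (verts-bound ma) (trans e embed₃-B))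
  ... | off-AB b≢A b≢B = ⊥-elim (<⇒≢+ (m + b) (verts-bound ma) (trans e (embed₃-other b≢A b≢B)))

  glued₂₃ : ∀ {a b} → a ∈ V → b ∈ V → embed₂ G a ≡ embed₃ G b → Glued G c₂ a c₃ b
  glued₂₃ {a} {b} ma mb e with view₂ a | view₃ b
  ... | at-A refl | at-A refl = ⊥-elim (B≢C (trans (sym embed₂-A) (trans e embed₃-A)))
  ... | at-A refl | at-B refl = ⊥-elim (<⇒≢+ (C G) B<m (trans (sym embed₂-A) (trans e embed₃-B)))
  ... | at-A refl | off-AB b≢A b≢B =
        ⊥-elim (<⇒≢+ (m + b) B<m (trans (sym embed₂-A) (trans e (embed₃-other b≢A b≢B))))
  ... | off-A a≢A | at-A refl = ⊥-elim (<⇒≢+ a C<m (sym (trans (sym (embed₂-other a≢A)) (trans e embed₃-A))))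
  ... | off-A a≢A | at-B refl = +-cancelˡ-≡ m a (C G) (trans (sym (embed₂-other a≢A)) (trans e embed₃-B)) , refl
  ... | off-A a≢A | off-AB b≢A b≢B = ⊥-elim (<⇒≢+ b (verts-bound ma)
        (+-cancelˡ-≡ m a (m + b) (trans (sym (embed₂-other a≢A)) (trans e (embed₃-other b≢A b≢B)))))

  embed₂-injective : ∀ {x y} → embed₂ G x ≡ embed₂ G y → x ≡ y
  embed₂-injective {x} {y} e with view₂ x | view₂ y
  ... | at-A refl | at-A refl = refl
  ... | at-A refl | off-A y≢A = ⊥-elim (<⇒≢+ y B<m (trans (sym embed₂-A) (trans e (embed₂-other y≢A))))
  ... | off-A x≢A | at-A refl = ⊥-elim (<⇒≢+ x B<m (sym (trans (sym (embed₂-other x≢A)) (trans e embed₂-A))))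
  ... | off-A x≢A | off-A y≢A = +-cancelˡ-≡ m x y (trans (sym (embed₂-other x≢A)) (trans e (embed₂-other y≢A)))

  embed₃-injective : ∀ {x y} → embed₃ G x ≡ embed₃ G y → x ≡ y
  embed₃-injective {x} {y} e with view₃ x | view₃ y
  ... | at-A refl | at-A refl = refl
  ... | at-B refl | at-B refl = refl
  ... | at-A refl | at-B refl = ⊥-elim (<⇒≢+ (C G) C<m (trans (sym embed₃-A) (trans e embed₃-B)))
  ... | at-B refl | at-A refl = ⊥-elim (<⇒≢+ (C G) C<m (sym (trans (sym embed₃-B) (trans e embed₃-A))))
  ... | at-A refl | off-AB y≢A y≢B =
        ⊥-elim (<⇒≢+ (m + y) C<m (trans (sym embed₃-A) (trans e (embed₃-other y≢A y≢B))))
  ... | off-AB x≢A x≢B | at-A refl =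
        ⊥-elim (<⇒≢+ (m + x) C<m (sym (trans (sym (embed₃-other x≢A x≢B)) (trans e embed₃-A))))
  ... | at-B refl | off-AB y≢A y≢B = ⊥-elim (<⇒≢+ y C<m
        (+-cancelˡ-≡ m (C G) (m + y) (trans (sym embed₃-B) (trans e (embed₃-other y≢A y≢B)))))
  ... | off-AB x≢A x≢B | at-B refl = ⊥-elim (<⇒≢+ x C<m
        (sym (+-cancelˡ-≡ m (m + x) (C G) (trans (sym (embed₃-other x≢A x≢B)) (trans e embed₃-B)))))
  ... | off-AB x≢A x≢B | off-AB y≢A y≢B = +-cancelˡ-≡ m x y
        (+-cancelˡ-≡ m (m + x) (m + y) (trans (sym (embed₃-other x≢A x≢B)) (trans e (embed₃-other y≢A y≢B))))

  embed-injective : ∀ θ {x y} → embed G θ x ≡ embed G θ y → x ≡ y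
  embed-injective c₁ e = e
  embed-injective c₂ e = embed₂-injective e
  embed-injective c₃ e = embed₃-injective e

  embed-glued : ∀ θ θ' {a b} → a ∈ V → b ∈ V → embed G θ a ≡ embed G θ' b → Glued G θ a θ' b
  embed-glued c₁ c₁ ma mb e = e
  embed-glued c₂ c₂ ma mb e = embed₂-injective e
  embed-glued c₃ c₃ ma mb e = embed₃-injective e
  embed-glued c₁ c₂ ma mb e = glued₁₂ ma e
  embed-glued c₁ c₃ ma mb e = glued₁₃ ma e
  embed-glued c₂ c₃ ma mb e = glued₂₃ ma mb e
  embed-glued c₂ c₁ ma mb e = swap (glued₁₂ mb (sym e))
  embed-glued c₃ c₁ ma mb e = swap (glued₁₃ mb (sym e))
  embed-glued c₃ c₂ ma mb e = swap (glued₂₃ mb ma (sym e))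

  Glued-same : ∀ θ {a b} → Glued G θ a θ b → a ≡ b
  Glued-same c₁ e = e
  Glued-same c₂ e = e
  Glued-same c₃ e = e

  Glued-functional : ∀ θ θ' {a b x y} → θ ≢ θ' → Glued G θ a θ' x → Glued G θ b θ' y → a ≡ b × x ≡ y
  Glued-functional c₁ c₁ θ≢θ' _ _ = ⊥-elim (θ≢θ' refl)
  Glued-functional c₂ c₂ θ≢θ' _ _ = ⊥-elim (θ≢θ' refl)
  Glued-functional c₃ c₃ θ≢θ' _ _ = ⊥-elim (θ≢θ' refl)
  Glued-functional c₁ c₂ _ (refl , refl) (refl , refl) = refl , refl
  Glued-functional c₂ c₁ _ (refl , refl) (refl , refl) = refl , refl
  Glued-functional c₁ c₃ _ (refl , refl) (refl , refl) = refl , refl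
  Glued-functional c₃ c₁ _ (refl , refl) (refl , refl) = refl , refl
  Glued-functional c₂ c₃ _ (refl , refl) (refl , refl) = refl , refl
  Glued-functional c₃ c₂ _ (refl , refl) (refl , refl) = refl , refl

  embed-∈ : ∀ θ {a} → a ∈ V → embed G θ a ∈ verts H
  embed-∈ c₁ ma = ∈-++⁺ˡ ma
  embed-∈ c₂ {a} ma with view₂ a
  ... | at-A refl = subst (_∈ verts H) (sym embed₂-A) (∈-++⁺ˡ B∈V)
  ... | off-A a≢A = ∈-++⁺ʳ V (∈-++⁺ˡ (∈-map⁺ (embed₂ G) (∈-filter⁺ (T? ∘ ≢Aᵇ) ma (≢⇒T-not-≡ᵇ a≢A))))
  embed-∈ c₃ {a} ma with view₃ a
  ... | at-A refl = subst (_∈ verts H) (sym embed₃-A) (∈-++⁺ˡ C∈V)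
  ... | at-B refl = subst (_∈ verts H) (trans embed₂-C (sym embed₃-B)) (embed-∈ c₂ C∈V)
  ... | off-AB a≢A a≢B = ∈-++⁺ʳ V (∈-++⁺ʳ _ (∈-map⁺ (embed₃ G) (∈-filter⁺ (T? ∘ ≢ABᵇ) ma
        (Equivalence.from T-∧ (≢⇒T-not-≡ᵇ a≢A , ≢⇒T-not-≡ᵇ a≢B)))))

  InCopy : Copy → ℕ → Set
  InCopy θ u = ∃[ c ] c ∈ V × u ≡ embed G θ c

  ∈-glue⁻ : ∀ {u} → u ∈ verts H → Σ[ θ ∈ Copy ] InCopy θ u
  ∈-glue⁻ {u} mu with ∈-++⁻ V mu
  ... | inj₁ m₁ = c₁ , u , m₁ , refl
  ... | inj₂ m₂ with ∈-++⁻ (map (embed₂ G) (filterᵇ ≢Aᵇ V)) m₂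
  ... | inj₁ m₃ = let (a , ma , e) = ∈-map⁻ (embed₂ G) m₃ in c₂ , a , proj₁ (∈-filter⁻ (T? ∘ ≢Aᵇ) {xs = V} ma) , e
  ... | inj₂ m₃ = let (a , ma , e) = ∈-map⁻ (embed₃ G) m₃ in c₃ , a , proj₁ (∈-filter⁻ (T? ∘ ≢ABᵇ) {xs = V} ma) , e

  ∈-edges-glue⁺ : ∀ θ {a b} → (a , b) ∈ edges G → (embed G θ a , embed G θ b) ∈ edges H
  ∈-edges-glue⁺ c₁ m = ∈-++⁺ˡ m
  ∈-edges-glue⁺ c₂ m = ∈-++⁺ʳ (edges G) (∈-++⁺ˡ (∈-map⁺ _ m))
  ∈-edges-glue⁺ c₃ m = ∈-++⁺ʳ (edges G) (∈-++⁺ʳ _ (∈-map⁺ _ m))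

  ∈-edges-glue⁻ : ∀ {u v} → (u , v) ∈ edges H →
                  Σ[ θ ∈ Copy ] ∃[ a ] ∃[ b ] (a , b) ∈ edges G × u ≡ embed G θ a × v ≡ embed G θ b
  ∈-edges-glue⁻ {u} {v} m with ∈-++⁻ (edges G) m
  ... | inj₁ m₁ = c₁ , u , v , m₁ , refl , refl
  ... | inj₂ m₂ with ∈-++⁻ (map _ (edges G)) m₂
  ... | inj₁ m₃ = let ((a , b) , mab , e) = ∈-map⁻ _ m₃ in c₂ , a , b , mab , cong proj₁ e , cong proj₂ e
  ... | inj₂ m₃ = let ((a , b) , mab , e) = ∈-map⁻ _ m₃ in c₃ , a , b , mab , cong proj₁ e , cong proj₂ e

  CopyEdge : ℕ → ℕ → Set
  CopyEdge u v = Σ[ θ ∈ Copy ] ∃[ a ] ∃[ b ] Adj G a b × u ≡ embed G θ a × v ≡ embed G θ b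

  embed-adj : ∀ θ {a b} → Adj G a b → Adj H (embed G θ a) (embed G θ b)
  embed-adj θ = edge⇒adj H ∘ Sum.map (∈-edges-glue⁺ θ) (∈-edges-glue⁺ θ) ∘ adj⇒edge G

  adj-glue⁻ : ∀ {u v} → Adj H u v → CopyEdge u v
  adj-glue⁻ uv with adj⇒edge H uv
  ... | inj₁ m = let (θ , a , b , mab , e₁ , e₂) = ∈-edges-glue⁻ m in θ , a , b , edge⇒adj G (inj₁ mab) , e₁ , e₂
  ... | inj₂ m = let (θ , a , b , mab , e₁ , e₂) = ∈-edges-glue⁻ m in θ , b , a , edge⇒adj G (inj₂ mab) , e₂ , e₁

  adj⇒∈V² : ∀ {a b} → Adj G a b → a ∈ V × b ∈ V
  adj⇒∈V² ab = adj⇒∈V ab , adj⇒∈V (adj-sym G ab)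

  embed-adj⇔ : ∀ θ {a b} → a ∈ V → b ∈ V → Adj H (embed G θ a) (embed G θ b) ⇔ Adj G a b
  embed-adj⇔ θ {a} {b} ma mb = mk⇔ reflect (embed-adj θ)
    where
      reflect : Adj H (embed G θ a) (embed G θ b) → Adj G a b
      reflect ab with adj-glue⁻ ab
      ... | θ' , x , y , xy , e₁ , e₂ with adj⇒∈V² xy | θ ≟ᶜ θ'
      ... | mx , my | yes refl
            rewrite Glued-same θ (embed-glued θ θ ma mx e₁) | Glued-same θ (embed-glued θ θ mb my e₂) = xy
      ... | mx , my | no θ≢θ' with Glued-functional θ θ' θ≢θ' (embed-glued θ θ' ma mx e₁) (embed-glued θ θ' mb my e₂)
      ... | _ , refl = ⊥-elim (irreflexive xy)

  ¬adj-distinct-corners : ∀ θ θ' θ'' {a b x y} → Glued G θ a θ'' x → Glued G θ' b θ'' y →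
                          θ ≢ θ' → θ ≢ θ'' → θ' ≢ θ'' → ¬ Adj G x y
  ¬adj-distinct-corners c₁ c₂ c₃ (_ , refl) (_ , refl) _ _ _ = ¬adj-AB
  ¬adj-distinct-corners c₂ c₁ c₃ (_ , refl) (_ , refl) _ _ _ = ¬adj-AB ∘ adj-sym G
  ¬adj-distinct-corners c₁ c₃ c₂ (_ , refl) (_ , refl) _ _ _ = ¬adj-AC
  ¬adj-distinct-corners c₃ c₁ c₂ (_ , refl) (_ , refl) _ _ _ = ¬adj-AC ∘ adj-sym G
  ¬adj-distinct-corners c₂ c₃ c₁ (_ , refl) (_ , refl) _ _ _ = ¬adj-BC
  ¬adj-distinct-corners c₃ c₂ c₁ (_ , refl) (_ , refl) _ _ _ = ¬adj-BC ∘ adj-sym G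
  ¬adj-distinct-corners c₁ c₁ _ _ _ n _ _ = ⊥-elim (n refl)
  ¬adj-distinct-corners c₂ c₂ _ _ _ n _ _ = ⊥-elim (n refl)
  ¬adj-distinct-corners c₃ c₃ _ _ _ n _ _ = ⊥-elim (n refl)
  ¬adj-distinct-corners c₁ _ c₁ _ _ _ n _ = ⊥-elim (n refl)
  ¬adj-distinct-corners c₂ _ c₂ _ _ _ n _ = ⊥-elim (n refl)
  ¬adj-distinct-corners c₃ _ c₃ _ _ _ n _ = ⊥-elim (n refl)
  ¬adj-distinct-corners _ c₁ c₁ _ _ _ _ n = ⊥-elim (n refl)
  ¬adj-distinct-corners _ c₂ c₂ _ _ _ _ n = ⊥-elim (n refl)
  ¬adj-distinct-corners _ c₃ c₃ _ _ _ _ n = ⊥-elim (n refl)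

  adj-across : ∀ θ θ' {a b} → θ ≢ θ' → a ∈ V → b ∈ V → Adj H (embed G θ a) (embed G θ' b) →
               InCopy θ' (embed G θ a) ⊎ InCopy θ (embed G θ' b)
  adj-across θ θ' θ≢θ' ma mb ab with adj-glue⁻ ab
  ... | θ'' , x , y , xy , e₁ , e₂ with adj⇒∈V² xy | θ ≟ᶜ θ'' | θ' ≟ᶜ θ''
  ... | _ , my | yes refl | _ = inj₂ (y , my , e₂)
  ... | mx , _ | no _ | yes refl = inj₁ (x , mx , e₁)
  ... | mx , my | no θ≢θ'' | no θ'≢θ'' = ⊥-elim (¬adj-distinct-corners θ θ' θ''
        (embed-glued θ θ'' ma mx e₁) (embed-glued θ' θ'' mb my e₂) θ≢θ' θ≢θ'' θ'≢θ'' xy)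

  3m≡ : 3 * m ≡ m + (m + m)
  3m≡ = cong (λ k → m + (m + k)) (+-identityʳ m)

  embed-bound : ∀ θ {a} → a ∈ V → embed G θ a < 3 * m
  embed-bound θ {a} ma = subst (embed G θ a <_) (sym 3m≡) (below θ)
    where
      copy₁ : ∀ {x} → x < m → x < m + (m + m)
      copy₁ x<m = <-≤-trans x<m (m≤m+n m (m + m))
      copy₂ : ∀ {x} → x < m → m + x < m + (m + m)
      copy₂ x<m = <-≤-trans (+-monoʳ-< m x<m) (+-monoʳ-≤ m (m≤m+n m m))
      copy₃ : ∀ {x} → x < m → m + (m + x) < m + (m + m)
      copy₃ x<m = +-monoʳ-< m (+-monoʳ-< m x<m)
      below : ∀ θ → embed G θ a < m + (m + m)
      below c₁ = copy₁ (verts-bound ma)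
      below c₂ with view₂ a
      ... | at-A refl = subst (_< m + (m + m)) (sym embed₂-A) (copy₁ B<m)
      ... | off-A a≢A = subst (_< m + (m + m)) (sym (embed₂-other a≢A)) (copy₂ (verts-bound ma))
      below c₃ with view₃ a
      ... | at-A refl = subst (_< m + (m + m)) (sym embed₃-A) (copy₁ C<m)
      ... | at-B refl = subst (_< m + (m + m)) (sym embed₃-B) (copy₂ C<m)
      ... | off-AB a≢A a≢B = subst (_< m + (m + m)) (sym (embed₃-other a≢A a≢B)) (copy₃ (verts-bound ma))

  glue-verts-unique : Unique (verts H)
  glue-verts-unique = Unique.++⁺ verts-unique
    (Unique.++⁺ (Unique.map⁺ embed₂-injective (Unique.filter⁺ (T? ∘ ≢Aᵇ) verts-unique))
                (Unique.map⁺ embed₃-injective (Unique.filter⁺ (T? ∘ ≢ABᵇ) verts-unique)) copies₂₃-disjoint)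
    copy₁-disjoint
    where
      copies₂₃-disjoint : Disjoint (map (embed₂ G) (filterᵇ ≢Aᵇ V)) (map (embed₃ G) (filterᵇ ≢ABᵇ V))
      copies₂₃-disjoint (m₂ , m₃) with ∈-map⁻ (embed₂ G) m₂ | ∈-map⁻ (embed₃ G) m₃
      ... | a , ma , refl | b , mb , e with ∈-filter⁻ (T? ∘ ≢Aᵇ) {xs = V} ma | ∈-filter⁻ (T? ∘ ≢ABᵇ) {xs = V} mb
      ... | ma' , _ | mb' , b∉AB = T-not-≡ᵇ⇒≢ (proj₂ (Equivalence.to T-∧ b∉AB)) (proj₂ (glued₂₃ ma' mb' e))
      copy₁-disjoint : Disjoint V (map (embed₂ G) (filterᵇ ≢Aᵇ V) ++ map (embed₃ G) (filterᵇ ≢ABᵇ V))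
      copy₁-disjoint (mz , m) with ∈-++⁻ (map (embed₂ G) (filterᵇ ≢Aᵇ V)) m
      ... | inj₁ m₂ = let (b , mb , e) = ∈-map⁻ (embed₂ G) m₂ in
                      T-not-≡ᵇ⇒≢ (proj₂ (∈-filter⁻ (T? ∘ ≢Aᵇ) {xs = V} mb)) (proj₂ (glued₁₂ mz e))
      ... | inj₂ m₃ = let (b , mb , e) = ∈-map⁻ (embed₃ G) m₃ in
                      T-not-≡ᵇ⇒≢ (proj₁ (Equivalence.to T-∧ (proj₂ (∈-filter⁻ (T? ∘ ≢ABᵇ) {xs = V} mb))))
                                 (proj₂ (glued₁₃ {b = b} mz e))

  ¬adj-across : ∀ θ θ' {a b} → θ ≢ θ' → a ∈ V → b ∈ V → ¬ InCopy θ' (embed G θ a) → ¬ InCopy θ (embed G θ' b) →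
                ¬ Adj H (embed G θ a) (embed G θ' b)
  ¬adj-across θ θ' θ≢θ' ma mb a∉θ' b∉θ = Sum.[ a∉θ' , b∉θ ]′ ∘ adj-across θ θ' θ≢θ' ma mb

  glue-wellFormed : WellFormed H
  glue-wellFormed = record
    { verts-unique = glue-verts-unique
    ; verts-bound = λ mu → let (θ , a , ma , e) = ∈-glue⁻ mu in subst (_< 3 * m) (sym e) (embed-bound θ ma)
    ; A∈V = ∈-++⁺ˡ A∈V
    ; B∈V = embed-∈ c₂ B∈V
    ; C∈V = embed-∈ c₃ C∈V
    ; A≢B = A≢B ∘ proj₁ ∘ glued₁₂ A∈V
    ; A≢C = A≢C ∘ proj₁ ∘ glued₁₃ {b = C G} A∈V
    ; B≢C = B≢C ∘ proj₁ ∘ glued₂₃ B∈V C∈V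
    ; irreflexive = λ uu → let (θ , a , b , ab , e₁ , e₂) = adj-glue⁻ uu in
                           irreflexive (subst (Adj G a) (sym (embed-injective θ (trans (sym e₁) e₂))) ab)
    ; adj⇒∈V = λ uv → let (θ , a , b , ab , e₁ , _) = adj-glue⁻ uv in
                      subst (_∈ verts H) (sym e₁) (embed-∈ θ (adj⇒∈V ab))
    ; ¬adj-AB = ¬adj-across c₁ c₂ (λ ()) A∈V B∈V
                  (λ (_ , _ , e) → A≢B (proj₁ (glued₁₂ A∈V e)))
                  (λ (_ , mc , e) → A≢B (sym (proj₂ (glued₁₂ mc (sym e)))))
    ; ¬adj-AC = ¬adj-across c₁ c₃ (λ ()) A∈V C∈V
                  (λ (c , _ , e) → A≢C (proj₁ (glued₁₃ {b = c} A∈V e)))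
                  (λ (_ , mc , e) → A≢C (sym (proj₂ (glued₁₃ {b = C G} mc (sym e)))))
    ; ¬adj-BC = ¬adj-across c₂ c₃ (λ ()) B∈V C∈V
                  (λ (_ , mc , e) → B≢C (proj₁ (glued₂₃ B∈V mc e)))
                  (λ (_ , mc , e) → B≢C (sym (proj₂ (glued₂₃ mc C∈V (sym e)))))
    }

  ∈V⇒≢B : ∀ {x} → x ∈ V → x ≢ B H
  ∈V⇒≢B mx e = A≢B (sym (proj₂ (glued₁₂ mx e)))

  ∈V⇒≢C : ∀ {x} → x ∈ V → x ≢ C H
  ∈V⇒≢C mx e = A≢C (sym (proj₂ (glued₁₃ {b = C G} mx e)))

  adj-A⁻ : ∀ {u} → Adj H (A G) u → Adj G (A G) u
  adj-A⁻ Au with adj-glue⁻ Au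
  ... | c₁ , a , b , ab , refl , refl = ab
  ... | c₂ , a , b , ab , e , _ = ⊥-elim (A≢B (proj₁ (glued₁₂ A∈V e)))
  ... | c₃ , a , b , ab , e , _ = ⊥-elim (A≢C (proj₁ (glued₁₃ {b = a} A∈V e)))

-- Remainder pairs

record Remainder (G : Gr) (S p : List ℕ) : Set where
  field
    S-unique : Unique S
    S⊆V : ∀ {d} → d ∈ S → d ∈ verts G
    path : InducedPath G p
    p⊆V : ∀ {u} → u ∈ p → u ∈ verts G
    covered : ∀ {u} → u ∈ verts G → u ∈ p ⊎ ∃[ d ] d ∈ S × Neighbour G d u
    undominated : ∀ {u d} → u ∈ p → d ∈ S → ¬ Neighbour G d u
    two-contacts : ∀ {v u} → v ∈ verts G → v ∉ p → u ∈ p → Adj G v u →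
                   ∃[ u' ] u' ∈ p × u' ≢ u × Adj G v u'

module _ {G S p} (rem : Remainder G S p) where
  open Remainder rem

  Pi-avoids-path : ∀ n {u} → T (Pi G S n u) → u ∉ p
  Pi-avoids-path zero t up with P0⁻ G S t
  ... | d , md , mu = undominated up md (proj₂ (∈-nbhd⁻ G d mu))
  Pi-avoids-path (suc n) t up with Pstep⁻ G (Pi G S n) t
  ... | v , can@(mv , pv , _) , mu with proj₂ (∈-nbhd⁻ G v mu)
  ... | inj₁ refl = Pi-avoids-path n pv up
  ... | inj₂ vu with two-contacts mv (Pi-avoids-path n pv) up vu
  ... | u' , mu' , u'≢u , vu' =
        ¬CanForce-two G (Pi G S n) can mu (∈-nbhd⁺ G v (p⊆V mu') (inj₂ vu')) (u'≢u ∘ sym)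
          (λ t → Pi-avoids-path n t up) (λ t → Pi-avoids-path n t mu')

  remainderIsPath : ∀ {x y mid} → p ≡ x ∷ (mid ∷ʳ y) → RemainderIsPath G S p x y
  remainderIsPath {mid = mid} p≡ =
    proj₁ path ,
    (λ u → mk⇔ (λ up → p⊆V up , λ (n , e) → Pi-avoids-path n (Equivalence.from T-≡ e) up)
               (λ (mu , unobserved) → off-S mu unobserved)) ,
    (mid , p≡) ,
    (λ u v mu mv → proj₂ path u v mu mv ⇔-∘ ⇔-sym T-≡)
    where
      off-S : ∀ {u} → u ∈ verts G → ¬ InPinf G S u → u ∈ p
      off-S mu unobserved with covered mu
      ... | inj₁ up = up
      ... | inj₂ (d , md , nb) = ⊥-elim (unobserved (0 , Equivalence.to T-≡ (P0⁺ G S md (∈-nbhd⁺ G d mu nb))))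

module GlueRemainder (G : Gr) (wf : WellFormed G) (S P : Copy → List ℕ) (rem : ∀ θ → Remainder G (S θ) (P θ))
  (P-consistent : ∀ θ θ' {a b} → a ∈ verts G → b ∈ verts G → embed G θ a ≡ embed G θ' b → a ∈ P θ → b ∈ P θ')
  (S-consistent : ∀ θ θ' {a b} → a ∈ verts G → b ∈ verts G → embed G θ a ≡ embed G θ' b → a ∈ S θ → b ∈ S θ')
  {S' p' : List ℕ}
  (∈S'⁻ : ∀ {u} → u ∈ S' → Σ[ θ ∈ Copy ] ∃[ a ] a ∈ S θ × u ≡ embed G θ a)
  (∈S'⁺ : ∀ θ {a} → a ∈ S θ → embed G θ a ∈ S')
  (∈p'⁻ : ∀ {u} → u ∈ p' → Σ[ θ ∈ Copy ] ∃[ a ] a ∈ P θ × u ≡ embed G θ a)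
  (∈p'⁺ : ∀ θ {a} → a ∈ P θ → embed G θ a ∈ p')
  (S'-unique : Unique S') (p'-path : InducedPath (glue G) p') where

  open GlueProperties G wf
  module R θ = Remainder (rem θ)

  covered : ∀ {u} → u ∈ verts H → u ∈ p' ⊎ ∃[ d ] d ∈ S' × Neighbour H d u
  covered mu with ∈-glue⁻ mu
  ... | θ , a , ma , refl with R.covered θ ma
  ... | inj₁ ap = inj₁ (∈p'⁺ θ ap)
  ... | inj₂ (d , md , inj₁ refl) = inj₂ (embed G θ d , ∈S'⁺ θ md , inj₁ refl)
  ... | inj₂ (d , md , inj₂ da) = inj₂ (embed G θ d , ∈S'⁺ θ md , inj₂ (embed-adj θ da))

  undominated : ∀ {u d} → u ∈ p' → d ∈ S' → ¬ Neighbour H d u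
  undominated up dS nb with ∈p'⁻ up | ∈S'⁻ dS
  undominated up dS (inj₁ e) | θ , a , ap , refl | θ' , x , xS , refl =
    R.undominated θ' (P-consistent θ θ' (R.p⊆V θ ap) (R.S⊆V θ' xS) e ap) xS (inj₁ refl)
  undominated up dS (inj₂ da) | θ , a , ap , refl | θ' , x , xS , refl with adj-glue⁻ da
  ... | θ'' , e₁ , e₂ , e₁e₂ , q₁ , q₂ with adj⇒∈V² e₁e₂
  ... | me₁ , me₂ = R.undominated θ'' (P-consistent θ θ'' (R.p⊆V θ ap) me₂ q₂ ap)
                      (S-consistent θ' θ'' (R.S⊆V θ' xS) me₁ q₁ xS) (inj₂ e₁e₂)

  two-contacts : ∀ {v u} → v ∈ verts H → v ∉ p' → u ∈ p' → Adj H v u →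
                 ∃[ u' ] u' ∈ p' × u' ≢ u × Adj H v u'
  two-contacts mv v∉p' up vu with adj-glue⁻ vu | ∈p'⁻ up
  ... | θ , x , y , xy , refl , refl | θ' , a , ap , e with adj⇒∈V² xy
  ... | mx , my with R.two-contacts θ mx (v∉p' ∘ ∈p'⁺ θ) (P-consistent θ' θ (R.p⊆V θ' ap) my (sym e) ap) xy
  ... | y' , y'p , y'≢y , xy' = embed G θ y' , ∈p'⁺ θ y'p , y'≢y ∘ embed-injective θ , embed-adj θ xy'

  remainder : Remainder H S' p'
  remainder = record
    { S-unique = S'-unique
    ; S⊆V = λ dS → let (θ , a , aS , e) = ∈S'⁻ dS in subst (_∈ verts H) (sym e) (embed-∈ θ (R.S⊆V θ aS))
    ; path = p'-path
    ; p⊆V = λ up → let (θ , a , ap , e) = ∈p'⁻ up in subst (_∈ verts H) (sym e) (embed-∈ θ (R.p⊆V θ ap))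
    ; covered = covered
    ; undominated = undominated
    ; two-contacts = two-contacts
    }

module Assembly (G : Gr) (wf : WellFormed G) (S P : Copy → List ℕ) (rem : ∀ θ → Remainder G (S θ) (P θ)) where
  open WellFormed wf
  open GlueProperties G wf
  module R θ = Remainder (rem θ)

  P∩S : ∀ θ {x} → x ∈ P θ → x ∉ S θ
  P∩S θ xP xS = R.undominated θ xP xS (inj₁ refl)

  SameStatus : Copy → ℕ → Copy → ℕ → Set
  SameStatus θ x θ' y = (x ∈ P θ × y ∈ P θ') ⊎ (x ∈ S θ × y ∈ S θ')

  Agree : Copy → ℕ → Copy → ℕ → Set
  Agree θ x θ' y = (x ∈ P θ ⇔ y ∈ P θ') × (x ∈ S θ ⇔ y ∈ S θ')

  agree : ∀ {θ x θ' y} → SameStatus θ x θ' y → Agree θ x θ' y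
  agree {θ} {θ' = θ'} (inj₁ (xP , yP)) =
    mk⇔ (const yP) (const xP) , mk⇔ (⊥-elim ∘ P∩S θ xP) (⊥-elim ∘ P∩S θ' yP)
  agree {θ} {θ' = θ'} (inj₂ (xS , yS)) =
    mk⇔ (λ xP → ⊥-elim (P∩S θ xP xS)) (λ yP → ⊥-elim (P∩S θ' yP yS)) , mk⇔ (const yS) (const xS)

  agree-sym : ∀ {θ x θ' y} → Agree θ x θ' y → Agree θ' y θ x
  agree-sym (p , s) = ⇔-sym p , ⇔-sym s

  module Consistency (s₁₂ : SameStatus c₁ (B G) c₂ (A G)) (s₁₃ : SameStatus c₁ (C G) c₃ (A G))
                     (s₂₃ : SameStatus c₂ (C G) c₃ (B G)) where

    glued-agree : ∀ θ θ' {a b} → Glued G θ a θ' b → Agree θ a θ' b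
    glued-agree c₁ c₁ refl = ⇔-id _ , ⇔-id _
    glued-agree c₂ c₂ refl = ⇔-id _ , ⇔-id _
    glued-agree c₃ c₃ refl = ⇔-id _ , ⇔-id _
    glued-agree c₁ c₂ (refl , refl) = agree s₁₂
    glued-agree c₂ c₁ (refl , refl) = agree-sym (agree s₁₂)
    glued-agree c₁ c₃ (refl , refl) = agree s₁₃
    glued-agree c₃ c₁ (refl , refl) = agree-sym (agree s₁₃)
    glued-agree c₂ c₃ (refl , refl) = agree s₂₃
    glued-agree c₃ c₂ (refl , refl) = agree-sym (agree s₂₃)

    P-consistent : ∀ θ θ' {a b} → a ∈ V → b ∈ V → embed G θ a ≡ embed G θ' b → a ∈ P θ → b ∈ P θ'
    P-consistent θ θ' ma mb e = Equivalence.to (proj₁ (glued-agree θ θ' (embed-glued θ θ' ma mb e)))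

    S-consistent : ∀ θ θ' {a b} → a ∈ V → b ∈ V → embed G θ a ≡ embed G θ' b → a ∈ S θ → b ∈ S θ'
    S-consistent θ θ' ma mb e = Equivalence.to (proj₂ (glued-agree θ θ' (embed-glued θ θ' ma mb e)))

  OnPath : Copy → ℕ → Set
  OnPath θ u = ∃[ a ] a ∈ P θ × u ≡ embed G θ a

  MeetsOnlyAt : Copy → Copy → ℕ → Set
  MeetsOnlyAt θ θ' s = ∀ {a b} → a ∈ P θ → Glued G θ a θ' b → embed G θ a ≡ s

  meet : ∀ {θ θ' s u} → MeetsOnlyAt θ θ' s → OnPath θ u → OnPath θ' u → u ≡ s
  meet {θ} {θ'} θ∩θ' (a , aP , refl) (b , bP , e) = θ∩θ' aP (embed-glued θ θ' (R.p⊆V θ aP) (R.p⊆V θ' bP) e)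

  paths-¬adj : ∀ {θ θ' s u v} → θ ≢ θ' → MeetsOnlyAt θ θ' s → MeetsOnlyAt θ' θ s →
                OnPath θ u → OnPath θ' v → u ≢ s → v ≢ s → ¬ Adj H u v
  paths-¬adj {θ} {θ'} θ≢θ' θ∩θ' θ'∩θ (a , aP , refl) (b , bP , refl) u≢s v≢s uv
    with adj-across θ θ' θ≢θ' (R.p⊆V θ aP) (R.p⊆V θ' bP) uv
  ... | inj₁ (c , mc , e) = u≢s (θ∩θ' aP (embed-glued θ θ' (R.p⊆V θ aP) mc e))
  ... | inj₂ (c , mc , e) = v≢s (θ'∩θ bP (embed-glued θ' θ (R.p⊆V θ' bP) mc e))

  record Piece (θ : Copy) (q : List ℕ) : Set where
    field
      induced : InducedPath H q
      ∈⁻ : ∀ {u} → u ∈ q → OnPath θ u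
      ∈⁺ : ∀ {a} → a ∈ P θ → embed G θ a ∈ q

  piece : ∀ θ {q} → map (embed G θ) (P θ) ≡ q → Piece θ q
  piece θ refl = record
    { induced = InducedPath-map G H (embed G θ) (embed-injective θ) (P θ)
                  (λ ma mb → embed-adj⇔ θ (R.p⊆V θ ma) (R.p⊆V θ mb)) (R.path θ)
    ; ∈⁻ = ∈-map⁻ (embed G θ)
    ; ∈⁺ = ∈-map⁺ (embed G θ)
    }

  piece-reverse : ∀ θ {q} → reverse (map (embed G θ) (P θ)) ≡ q → Piece θ q
  piece-reverse θ refl = record
    { induced = InducedPath-reverse H _ (Piece.induced (piece θ refl))
    ; ∈⁻ = ∈-map⁻ (embed G θ) ∘ reverse⁻
    ; ∈⁺ = reverse⁺ ∘ ∈-map⁺ (embed G θ)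
    }

  module Join₃ {θa θb θc} (θa≢θb : θa ≢ θb) (θa≢θc : θa ≢ θc) (θb≢θc : θb ≢ θc)
    (xs : List ℕ) (s₁ : ℕ) (mid : List ℕ) (s₂ : ℕ) (zs : List ℕ)
    (pa : Piece θa (xs ∷ʳ s₁)) (pb : Piece θb (s₁ ∷ (mid ∷ʳ s₂))) (pc : Piece θc (s₂ ∷ zs))
    (a∩b : MeetsOnlyAt θa θb s₁) (b∩a : MeetsOnlyAt θb θa s₁)
    (a∩c : MeetsOnlyAt θa θc s₂) (c∩a : MeetsOnlyAt θc θa s₂)
    (b∩c : MeetsOnlyAt θb θc s₂) (c∩b : MeetsOnlyAt θc θb s₂) where

    open Piece

    ab : List ℕ
    ab = xs ++ s₁ ∷ mid

    ab∷ʳs₂ : ab ∷ʳ s₂ ≡ xs ++ s₁ ∷ (mid ∷ʳ s₂)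
    ab∷ʳs₂ = ++-assoc xs (s₁ ∷ mid) (s₂ ∷ [])

    path-ab : InducedPath H (ab ∷ʳ s₂)
    path-ab = subst (InducedPath H) (sym ab∷ʳs₂) (InducedPath-join H xs s₁ (mid ∷ʳ s₂) (induced pa) (induced pb)
      (λ m₁ m₂ → meet a∩b (∈⁻ pa m₁) (∈⁻ pb m₂))
      (λ m₁ m₂ → paths-¬adj θa≢θb a∩b b∩a (∈⁻ pa m₁) (∈⁻ pb m₂)))

    ∈ab⁻ : ∀ {u} → u ∈ ab ∷ʳ s₂ → OnPath θa u ⊎ OnPath θb u
    ∈ab⁻ m = Sum.map (∈⁻ pa ∘ ∈-++⁺ˡ) (∈⁻ pb) (∈-++⁻ xs (subst (_ ∈_) ab∷ʳs₂ m))

    q : List ℕ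
    q = ab ++ s₂ ∷ zs

    induced-q : InducedPath H q
    induced-q = InducedPath-join H ab s₂ zs path-ab (induced pc)
      (λ m₁ m₂ → Sum.[ (λ a → meet a∩c a (∈⁻ pc m₂)) , (λ b → meet b∩c b (∈⁻ pc m₂)) ] (∈ab⁻ m₁))
      (λ m₁ m₂ → Sum.[ (λ a → paths-¬adj θa≢θc a∩c c∩a a (∈⁻ pc m₂))
                     , (λ b → paths-¬adj θb≢θc b∩c c∩b b (∈⁻ pc m₂)) ] (∈ab⁻ m₁))

    ∈q⁻ : ∀ {u} → u ∈ q → Σ[ θ ∈ Copy ] OnPath θ u
    ∈q⁻ m with ∈-++⁻ ab m
    ... | inj₂ mc = θc , ∈⁻ pc mc
    ... | inj₁ mab with ∈ab⁻ (∈-++⁺ˡ mab)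
    ... | inj₁ a = θa , a
    ... | inj₂ b = θb , b

    ∈ab∷ʳs₂⇒∈q : ∀ {u} → u ∈ ab ∷ʳ s₂ → u ∈ q
    ∈ab∷ʳs₂⇒∈q m with ∈-++⁻ ab m
    ... | inj₁ m₁ = ∈-++⁺ˡ m₁
    ... | inj₂ (here refl) = ∈-++⁺ʳ ab (here refl)

    ∈a⇒∈q : ∀ {u} → u ∈ xs ∷ʳ s₁ → u ∈ q
    ∈a⇒∈q m with ∈-++⁻ xs m
    ... | inj₁ m₁ = ∈-++⁺ˡ (∈-++⁺ˡ m₁)
    ... | inj₂ (here refl) = ∈-++⁺ˡ (∈-++⁺ʳ xs (here refl))

    ∈b⇒∈q : ∀ {u} → u ∈ s₁ ∷ (mid ∷ʳ s₂) → u ∈ q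
    ∈b⇒∈q m = ∈ab∷ʳs₂⇒∈q (subst (_ ∈_) (sym ab∷ʳs₂) (∈-++⁺ʳ xs m))

    ∈c⇒∈q : ∀ {u} → u ∈ s₂ ∷ zs → u ∈ q
    ∈c⇒∈q = ∈-++⁺ʳ ab

  ImageOf : Copy → List ℕ → List ℕ → Set
  ImageOf θ X L = ∀ {u} → u ∈ L → ∃[ a ] a ∈ X × u ≡ embed G θ a

  copy₁-image : ∀ {X} → ImageOf c₁ X X
  copy₁-image m = _ , m , refl

  images-disjoint : ∀ θ θ' {X Y L M} → ImageOf θ X L → ImageOf θ' Y M →
                    (∀ {a} → a ∈ X → a ∈ V) → (∀ {b} → b ∈ Y → b ∈ V) →
                    (∀ {a b} → a ∈ X → b ∈ Y → ¬ Glued G θ a θ' b) → Disjoint L M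
  images-disjoint θ θ' imL imM X⊆V Y⊆V ¬glued (mL , mM) with imL mL | imM mM
  ... | a , aX , refl | b , bY , e = ¬glued aX bY (embed-glued θ θ' (X⊆V aX) (Y⊆V bY) e)

-- For each corner X, the seeds X ∷ restX and the path through the two other corners with
-- interior innerX form a remainder pair.
record Layout : Set where
  constructor layout
  field restA restB restC innerA innerB innerC : List ℕ
open Layout

RemainderA RemainderB RemainderC : Gr → Layout → Set
RemainderA G d = Remainder G (A G ∷ restA d) (B G ∷ (innerA d ∷ʳ C G))
RemainderB G d = Remainder G (B G ∷ restB d) (A G ∷ (innerB d ∷ʳ C G))
RemainderC G d = Remainder G (C G ∷ restC d) (A G ∷ (innerC d ∷ʳ B G))

Remainders : Gr → Layout → Set
Remainders G d = RemainderA G d × RemainderB G d × RemainderC G d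

-- The pair of glue G for corner A (resp. B, C) is assembled from the pairs of the three copies
-- for corners A, C, B (resp. C, B, A and B, A, C): two glued corners chain the three paths, and
-- the third glued corner lies in the seed sets of both its copies.
glue-layout : Gr → Layout → Layout
glue-layout G d = layout
  (restA d ++ map (embed₂ G) (C G ∷ restC d) ++ map (embed₃ G) (restB d))
  (map (embed₂ G) (restB d) ++ (C G ∷ restC d) ++ map (embed₃ G) (restA d))
  (map (embed₃ G) (restC d) ++ (B G ∷ restB d) ++ map (embed₂ G) (restA d))
  (reverse (map (embed₂ G) (innerC d)) ++ B G ∷ (innerA d ++ C G ∷ map (embed₃ G) (innerB d)))
  (innerC d ++ B G ∷ (map (embed₂ G) (innerB d) ++ embed₂ G (C G) ∷ map (embed₃ G) (innerA d)))
  (innerB d ++ C G ∷ (map (embed₃ G) (innerC d) ++ embed₂ G (C G) ∷ reverse (map (embed₂ G) (innerA d))))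

last∈ : ∀ x xs {y : ℕ} → y ∈ x ∷ (xs ∷ʳ y)
last∈ x xs = there (∈-++⁺ʳ xs (here refl))

map-∷-∷ʳ : ∀ (f : ℕ → ℕ) x xs y → map f (x ∷ (xs ∷ʳ y)) ≡ f x ∷ (map f xs ∷ʳ f y)
map-∷-∷ʳ f x xs y = cong (f x ∷_) (map-++ f xs (y ∷ []))

reverse-∷-∷ʳ : ∀ (x : ℕ) xs y → reverse (x ∷ (xs ∷ʳ y)) ≡ y ∷ (reverse xs ∷ʳ x)
reverse-∷-∷ʳ x xs y = trans (unfold-reverse x (xs ∷ʳ y)) (cong (_∷ʳ x) (reverse-++ xs (y ∷ [])))

join₃-shape : ∀ (x : ℕ) xs s₁ mid s₂ zs y →
              ((x ∷ xs) ++ s₁ ∷ mid) ++ s₂ ∷ (zs ∷ʳ y) ≡ x ∷ ((xs ++ s₁ ∷ (mid ++ s₂ ∷ zs)) ∷ʳ y)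
join₃-shape x xs s₁ mid s₂ zs y = cong (x ∷_) (begin
  (xs ++ s₁ ∷ mid) ++ s₂ ∷ (zs ++ y ∷ [])   ≡⟨ ++-assoc xs (s₁ ∷ mid) (s₂ ∷ (zs ++ y ∷ [])) ⟩
  xs ++ s₁ ∷ (mid ++ s₂ ∷ (zs ++ y ∷ []))   ≡⟨ cong (λ l → xs ++ s₁ ∷ l) (sym (++-assoc mid (s₂ ∷ zs) (y ∷ []))) ⟩
  xs ++ (s₁ ∷ (mid ++ s₂ ∷ zs)) ++ y ∷ []   ≡⟨ sym (++-assoc xs (s₁ ∷ (mid ++ s₂ ∷ zs)) (y ∷ [])) ⟩
  (xs ++ s₁ ∷ (mid ++ s₂ ∷ zs)) ++ y ∷ []   ∎)
  where open ≡-Reasoning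

module GlueA (G : Gr) (wf : WellFormed G) (d : Layout) (rA : RemainderA G d) (rB : RemainderB G d) (rC : RemainderC G d) where
  open WellFormed wf
  open GlueProperties G wf

  S P : Copy → List ℕ
  S c₁ = A G ∷ restA d
  S c₂ = C G ∷ restC d
  S c₃ = B G ∷ restB d
  P c₁ = B G ∷ (innerA d ∷ʳ C G)
  P c₂ = A G ∷ (innerC d ∷ʳ B G)
  P c₃ = A G ∷ (innerB d ∷ʳ C G)

  rem : ∀ θ → Remainder G (S θ) (P θ)
  rem c₁ = rA
  rem c₂ = rC
  rem c₃ = rB

  open Assembly G wf S P rem
  open Consistency (inj₁ (here refl , here refl)) (inj₁ (last∈ (B G) (innerA d) , here refl)) (inj₂ (here refl , here refl))

  d' : Layout
  d' = glue-layout G d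

  S' : List ℕ
  S' = A G ∷ restA d'

  ∈S'⁻ : ∀ {u} → u ∈ S' → Σ[ θ ∈ Copy ] ∃[ a ] a ∈ S θ × u ≡ embed G θ a
  ∈S'⁻ (here refl) = c₁ , A G , here refl , refl
  ∈S'⁻ (there m) with ∈-++⁻ (restA d) m
  ... | inj₁ m₁ = c₁ , _ , there m₁ , refl
  ... | inj₂ m₂ with ∈-++⁻ (map (embed₂ G) (S c₂)) m₂
  ... | inj₁ m₃ = c₂ , ∈-map⁻ (embed₂ G) m₃
  ... | inj₂ m₃ = let (a , ma , e) = ∈-map⁻ (embed₃ G) m₃ in c₃ , a , there ma , e

  ∈S'⁺ : ∀ θ {a} → a ∈ S θ → embed G θ a ∈ S'
  ∈S'⁺ c₁ (here refl) = here refl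
  ∈S'⁺ c₁ (there m) = there (∈-++⁺ˡ m)
  ∈S'⁺ c₂ m = there (∈-++⁺ʳ (restA d) (∈-++⁺ˡ (∈-map⁺ (embed₂ G) m)))
  ∈S'⁺ c₃ (here refl) = subst (_∈ S') (trans embed₂-C (sym embed₃-B)) (∈S'⁺ c₂ (here refl))
  ∈S'⁺ c₃ (there m) = there (∈-++⁺ʳ (restA d) (∈-++⁺ʳ (map (embed₂ G) (S c₂)) (∈-map⁺ (embed₃ G) m)))

  S'-unique : Unique S'
  S'-unique = Unique.++⁺ (R.S-unique c₁)
    (Unique.++⁺ (Unique.map⁺ embed₂-injective (R.S-unique c₂)) (Unique.map⁺ embed₃-injective (AllPairs.tail (R.S-unique c₃)))
      (images-disjoint c₂ c₃ (∈-map⁻ _) (∈-map⁻ _) (R.S⊆V c₂) (R.S⊆V c₃ ∘ there)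
        λ { _ mb (refl , refl) → Unique[x∷xs]⇒x∉xs (R.S-unique c₃) mb }))
    (Disjoint-++ʳ
      (images-disjoint c₁ c₂ copy₁-image (∈-map⁻ _) (R.S⊆V c₁) (R.S⊆V c₂)
        λ { _ mb (refl , refl) → P∩S c₂ (here refl) mb })
      (images-disjoint c₁ c₃ copy₁-image (∈-map⁻ _) (R.S⊆V c₁) (R.S⊆V c₃ ∘ there)
        λ { _ mb (refl , refl) → P∩S c₃ (here refl) (there mb) }))

  piece₂ : Piece c₂ ((embed₂ G (B G) ∷ reverse (map (embed₂ G) (innerC d))) ∷ʳ B G)
  piece₂ = piece-reverse c₂ (begin
    reverse (map (embed₂ G) (P c₂))
      ≡⟨ cong reverse (map-∷-∷ʳ (embed₂ G) (A G) (innerC d) (B G)) ⟩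
    reverse (embed₂ G (A G) ∷ (map (embed₂ G) (innerC d) ∷ʳ embed₂ G (B G)))
      ≡⟨ reverse-∷-∷ʳ (embed₂ G (A G)) (map (embed₂ G) (innerC d)) (embed₂ G (B G)) ⟩
    embed₂ G (B G) ∷ (reverse (map (embed₂ G) (innerC d)) ∷ʳ embed₂ G (A G))
      ≡⟨ cong (λ z → embed₂ G (B G) ∷ (reverse (map (embed₂ G) (innerC d)) ∷ʳ z)) embed₂-A ⟩
    embed₂ G (B G) ∷ (reverse (map (embed₂ G) (innerC d)) ∷ʳ B G) ∎)
    where open ≡-Reasoning

  piece₁ : Piece c₁ (P c₁)
  piece₁ = piece c₁ (map-id (P c₁))

  piece₃ : Piece c₃ (C G ∷ (map (embed₃ G) (innerB d) ∷ʳ embed₃ G (C G)))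
  piece₃ = piece c₃ (trans (map-∷-∷ʳ (embed₃ G) (A G) (innerB d) (C G))
                            (cong (λ z → z ∷ (map (embed₃ G) (innerB d) ∷ʳ embed₃ G (C G))) embed₃-A))

  meet₂₁ : MeetsOnlyAt c₂ c₁ (B G)
  meet₂₁ _ (refl , refl) = embed₂-A

  meet₁₂ : MeetsOnlyAt c₁ c₂ (B G)
  meet₁₂ _ (refl , refl) = refl

  meet₂₃ : MeetsOnlyAt c₂ c₃ (C G)
  meet₂₃ aP (refl , refl) = ⊥-elim (P∩S c₂ aP (here refl))

  meet₃₂ : MeetsOnlyAt c₃ c₂ (C G)
  meet₃₂ aP (refl , refl) = ⊥-elim (P∩S c₃ aP (here refl))

  meet₁₃ : MeetsOnlyAt c₁ c₃ (C G)
  meet₁₃ _ (refl , refl) = refl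

  meet₃₁ : MeetsOnlyAt c₃ c₁ (C G)
  meet₃₁ _ (refl , refl) = embed₃-A

  open Join₃ {c₂} {c₁} {c₃} (λ ()) (λ ()) (λ ())
    (embed₂ G (B G) ∷ reverse (map (embed₂ G) (innerC d))) (B G) (innerA d) (C G) (map (embed₃ G) (innerB d) ∷ʳ embed₃ G (C G))
    piece₂ piece₁ piece₃ meet₂₁ meet₁₂ meet₂₃ meet₃₂ meet₁₃ meet₃₁

  ∈q⁺ : ∀ θ {a} → a ∈ P θ → embed G θ a ∈ q
  ∈q⁺ c₁ = ∈b⇒∈q ∘ Piece.∈⁺ piece₁
  ∈q⁺ c₂ = ∈a⇒∈q ∘ Piece.∈⁺ piece₂
  ∈q⁺ c₃ = ∈c⇒∈q ∘ Piece.∈⁺ piece₃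

  q≡ : q ≡ B H ∷ (innerA d' ∷ʳ C H)
  q≡ = join₃-shape _ _ _ _ _ _ _

  result : RemainderA H d'
  result = subst (Remainder H S') q≡
    (GlueRemainder.remainder G wf S P rem P-consistent S-consistent ∈S'⁻ ∈S'⁺ ∈q⁻ ∈q⁺ S'-unique induced-q)

  pathA-extends : ∀ {a} → a ∈ P c₁ → a ∈ B H ∷ (innerA d' ∷ʳ C H)
  pathA-extends {a} = subst (a ∈_) q≡ ∘ ∈q⁺ c₁

module GlueB (G : Gr) (wf : WellFormed G) (d : Layout) (rA : RemainderA G d) (rB : RemainderB G d) (rC : RemainderC G d) where
  open WellFormed wf
  open GlueProperties G wf

  S P : Copy → List ℕ
  S c₁ = C G ∷ restC d
  S c₂ = B G ∷ restB d
  S c₃ = A G ∷ restA d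
  P c₁ = A G ∷ (innerC d ∷ʳ B G)
  P c₂ = A G ∷ (innerB d ∷ʳ C G)
  P c₃ = B G ∷ (innerA d ∷ʳ C G)

  rem : ∀ θ → Remainder G (S θ) (P θ)
  rem c₁ = rC
  rem c₂ = rB
  rem c₃ = rA

  open Assembly G wf S P rem
  open Consistency (inj₁ (last∈ (A G) (innerC d) , here refl)) (inj₂ (here refl , here refl))
                   (inj₁ (last∈ (A G) (innerB d) , here refl))

  d' : Layout
  d' = glue-layout G d

  S' : List ℕ
  S' = embed₂ G (B G) ∷ restB d'

  ∈S'⁻ : ∀ {u} → u ∈ S' → Σ[ θ ∈ Copy ] ∃[ a ] a ∈ S θ × u ≡ embed G θ a
  ∈S'⁻ m with ∈-++⁻ (map (embed₂ G) (S c₂)) m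
  ... | inj₁ m₁ = c₂ , ∈-map⁻ (embed₂ G) m₁
  ... | inj₂ m₂ with ∈-++⁻ (S c₁) m₂
  ... | inj₁ m₃ = c₁ , _ , m₃ , refl
  ... | inj₂ m₃ = let (a , ma , e) = ∈-map⁻ (embed₃ G) m₃ in c₃ , a , there ma , e

  ∈S'⁺ : ∀ θ {a} → a ∈ S θ → embed G θ a ∈ S'
  ∈S'⁺ c₂ m = ∈-++⁺ˡ (∈-map⁺ (embed₂ G) m)
  ∈S'⁺ c₁ m = ∈-++⁺ʳ (map (embed₂ G) (S c₂)) (∈-++⁺ˡ m)
  ∈S'⁺ c₃ (here refl) = subst (_∈ S') (sym embed₃-A) (∈S'⁺ c₁ (here refl))
  ∈S'⁺ c₃ (there m) = ∈-++⁺ʳ (map (embed₂ G) (S c₂)) (∈-++⁺ʳ (S c₁) (∈-map⁺ (embed₃ G) m))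

  S'-unique : Unique S'
  S'-unique = Unique.++⁺ (Unique.map⁺ embed₂-injective (R.S-unique c₂))
    (Unique.++⁺ (R.S-unique c₁) (Unique.map⁺ embed₃-injective (AllPairs.tail (R.S-unique c₃)))
      (images-disjoint c₁ c₃ copy₁-image (∈-map⁻ _) (R.S⊆V c₁) (R.S⊆V c₃ ∘ there)
        λ { _ mb (refl , refl) → Unique[x∷xs]⇒x∉xs (R.S-unique c₃) mb }))
    (Disjoint-++ʳ
      (images-disjoint c₂ c₁ (∈-map⁻ _) copy₁-image (R.S⊆V c₂) (R.S⊆V c₁)
        λ { ma _ (refl , refl) → P∩S c₂ (here refl) ma })
      (images-disjoint c₂ c₃ (∈-map⁻ _) (∈-map⁻ _) (R.S⊆V c₂) (R.S⊆V c₃ ∘ there)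
        λ { _ mb (refl , refl) → P∩S c₃ (here refl) (there mb) }))

  piece₁ : Piece c₁ (P c₁)
  piece₁ = piece c₁ (map-id (P c₁))

  piece₂ : Piece c₂ (B G ∷ (map (embed₂ G) (innerB d) ∷ʳ embed₂ G (C G)))
  piece₂ = piece c₂ (trans (map-∷-∷ʳ (embed₂ G) (A G) (innerB d) (C G))
                            (cong (λ z → z ∷ (map (embed₂ G) (innerB d) ∷ʳ embed₂ G (C G))) embed₂-A))

  piece₃ : Piece c₃ (embed₂ G (C G) ∷ (map (embed₃ G) (innerA d) ∷ʳ embed₃ G (C G)))
  piece₃ = piece c₃ (trans (map-∷-∷ʳ (embed₃ G) (B G) (innerA d) (C G))
                            (cong (λ z → z ∷ (map (embed₃ G) (innerA d) ∷ʳ embed₃ G (C G))) (trans embed₃-B (sym embed₂-C))))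

  meet₁₂ : MeetsOnlyAt c₁ c₂ (B G)
  meet₁₂ _ (refl , refl) = refl

  meet₂₁ : MeetsOnlyAt c₂ c₁ (B G)
  meet₂₁ _ (refl , refl) = embed₂-A

  meet₁₃ : MeetsOnlyAt c₁ c₃ (embed₂ G (C G))
  meet₁₃ aP (refl , refl) = ⊥-elim (P∩S c₁ aP (here refl))

  meet₃₁ : MeetsOnlyAt c₃ c₁ (embed₂ G (C G))
  meet₃₁ aP (refl , refl) = ⊥-elim (P∩S c₃ aP (here refl))

  meet₂₃ : MeetsOnlyAt c₂ c₃ (embed₂ G (C G))
  meet₂₃ _ (refl , refl) = refl

  meet₃₂ : MeetsOnlyAt c₃ c₂ (embed₂ G (C G))
  meet₃₂ _ (refl , refl) = trans embed₃-B (sym embed₂-C)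

  open Join₃ {c₁} {c₂} {c₃} (λ ()) (λ ()) (λ ())
    (A G ∷ innerC d) (B G) (map (embed₂ G) (innerB d)) (embed₂ G (C G)) (map (embed₃ G) (innerA d) ∷ʳ embed₃ G (C G))
    piece₁ piece₂ piece₃ meet₁₂ meet₂₁ meet₁₃ meet₃₁ meet₂₃ meet₃₂

  ∈q⁺ : ∀ θ {a} → a ∈ P θ → embed G θ a ∈ q
  ∈q⁺ c₁ = ∈a⇒∈q ∘ Piece.∈⁺ piece₁
  ∈q⁺ c₂ = ∈b⇒∈q ∘ Piece.∈⁺ piece₂
  ∈q⁺ c₃ = ∈c⇒∈q ∘ Piece.∈⁺ piece₃

  result : RemainderB H d'
  result = subst (Remainder H S') (join₃-shape _ _ _ _ _ _ _)
    (GlueRemainder.remainder G wf S P rem P-consistent S-consistent ∈S'⁻ ∈S'⁺ ∈q⁻ ∈q⁺ S'-unique induced-q)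

module GlueC (G : Gr) (wf : WellFormed G) (d : Layout) (rA : RemainderA G d) (rB : RemainderB G d) (rC : RemainderC G d) where
  open WellFormed wf
  open GlueProperties G wf

  S P : Copy → List ℕ
  S c₁ = B G ∷ restB d
  S c₂ = A G ∷ restA d
  S c₃ = C G ∷ restC d
  P c₁ = A G ∷ (innerB d ∷ʳ C G)
  P c₂ = B G ∷ (innerA d ∷ʳ C G)
  P c₃ = A G ∷ (innerC d ∷ʳ B G)

  rem : ∀ θ → Remainder G (S θ) (P θ)
  rem c₁ = rB
  rem c₂ = rA
  rem c₃ = rC

  open Assembly G wf S P rem
  open Consistency (inj₂ (here refl , here refl)) (inj₁ (last∈ (A G) (innerB d) , here refl))
                   (inj₁ (last∈ (B G) (innerA d) , last∈ (A G) (innerC d)))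

  d' : Layout
  d' = glue-layout G d

  S' : List ℕ
  S' = embed₃ G (C G) ∷ restC d'

  ∈S'⁻ : ∀ {u} → u ∈ S' → Σ[ θ ∈ Copy ] ∃[ a ] a ∈ S θ × u ≡ embed G θ a
  ∈S'⁻ m with ∈-++⁻ (map (embed₃ G) (S c₃)) m
  ... | inj₁ m₁ = c₃ , ∈-map⁻ (embed₃ G) m₁
  ... | inj₂ m₂ with ∈-++⁻ (S c₁) m₂
  ... | inj₁ m₃ = c₁ , _ , m₃ , refl
  ... | inj₂ m₃ = let (a , ma , e) = ∈-map⁻ (embed₂ G) m₃ in c₂ , a , there ma , e

  ∈S'⁺ : ∀ θ {a} → a ∈ S θ → embed G θ a ∈ S'
  ∈S'⁺ c₃ m = ∈-++⁺ˡ (∈-map⁺ (embed₃ G) m)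
  ∈S'⁺ c₁ m = ∈-++⁺ʳ (map (embed₃ G) (S c₃)) (∈-++⁺ˡ m)
  ∈S'⁺ c₂ (here refl) = subst (_∈ S') (sym embed₂-A) (∈S'⁺ c₁ (here refl))
  ∈S'⁺ c₂ (there m) = ∈-++⁺ʳ (map (embed₃ G) (S c₃)) (∈-++⁺ʳ (S c₁) (∈-map⁺ (embed₂ G) m))

  S'-unique : Unique S'
  S'-unique = Unique.++⁺ (Unique.map⁺ embed₃-injective (R.S-unique c₃))
    (Unique.++⁺ (R.S-unique c₁) (Unique.map⁺ embed₂-injective (AllPairs.tail (R.S-unique c₂)))
      (images-disjoint c₁ c₂ copy₁-image (∈-map⁻ _) (R.S⊆V c₁) (R.S⊆V c₂ ∘ there)
        λ { _ mb (refl , refl) → Unique[x∷xs]⇒x∉xs (R.S-unique c₂) mb }))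
    (Disjoint-++ʳ
      (images-disjoint c₃ c₁ (∈-map⁻ _) copy₁-image (R.S⊆V c₃) (R.S⊆V c₁)
        λ { ma _ (refl , refl) → P∩S c₃ (here refl) ma })
      (images-disjoint c₃ c₂ (∈-map⁻ _) (∈-map⁻ _) (R.S⊆V c₃) (R.S⊆V c₂ ∘ there)
        λ { ma _ (refl , refl) → P∩S c₃ (last∈ (A G) (innerC d)) ma }))

  piece₁ : Piece c₁ (P c₁)
  piece₁ = piece c₁ (map-id (P c₁))

  piece₃ : Piece c₃ (C G ∷ (map (embed₃ G) (innerC d) ∷ʳ embed₂ G (C G)))
  piece₃ = piece c₃ (trans (map-∷-∷ʳ (embed₃ G) (A G) (innerC d) (B G))
                            (cong₂ (λ z w → z ∷ (map (embed₃ G) (innerC d) ∷ʳ w)) embed₃-A (trans embed₃-B (sym embed₂-C))))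

  piece₂ : Piece c₂ (embed₂ G (C G) ∷ (reverse (map (embed₂ G) (innerA d)) ∷ʳ embed₂ G (B G)))
  piece₂ = piece-reverse c₂ (trans (cong reverse (map-∷-∷ʳ (embed₂ G) (B G) (innerA d) (C G)))
                                   (reverse-∷-∷ʳ (embed₂ G (B G)) (map (embed₂ G) (innerA d)) (embed₂ G (C G))))

  meet₁₃ : MeetsOnlyAt c₁ c₃ (C G)
  meet₁₃ _ (refl , refl) = refl

  meet₃₁ : MeetsOnlyAt c₃ c₁ (C G)
  meet₃₁ _ (refl , refl) = embed₃-A

  meet₁₂ : MeetsOnlyAt c₁ c₂ (embed₂ G (C G))
  meet₁₂ aP (refl , refl) = ⊥-elim (P∩S c₁ aP (here refl))

  meet₂₁ : MeetsOnlyAt c₂ c₁ (embed₂ G (C G))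
  meet₂₁ aP (refl , refl) = ⊥-elim (P∩S c₂ aP (here refl))

  meet₃₂ : MeetsOnlyAt c₃ c₂ (embed₂ G (C G))
  meet₃₂ _ (refl , refl) = trans embed₃-B (sym embed₂-C)

  meet₂₃ : MeetsOnlyAt c₂ c₃ (embed₂ G (C G))
  meet₂₃ _ (refl , refl) = refl

  open Join₃ {c₁} {c₃} {c₂} (λ ()) (λ ()) (λ ())
    (A G ∷ innerB d) (C G) (map (embed₃ G) (innerC d)) (embed₂ G (C G)) (reverse (map (embed₂ G) (innerA d)) ∷ʳ embed₂ G (B G))
    piece₁ piece₃ piece₂ meet₁₃ meet₃₁ meet₁₂ meet₂₁ meet₃₂ meet₂₃

  ∈q⁺ : ∀ θ {a} → a ∈ P θ → embed G θ a ∈ q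
  ∈q⁺ c₁ = ∈a⇒∈q ∘ Piece.∈⁺ piece₁
  ∈q⁺ c₃ = ∈b⇒∈q ∘ Piece.∈⁺ piece₃
  ∈q⁺ c₂ = ∈c⇒∈q ∘ Piece.∈⁺ piece₂

  result : RemainderC H d'
  result = subst (Remainder H S') (join₃-shape _ _ _ _ _ _ _)
    (GlueRemainder.remainder G wf S P rem P-consistent S-consistent ∈S'⁻ ∈S'⁺ ∈q⁻ ∈q⁺ S'-unique induced-q)

glue-remainders : ∀ G → WellFormed G → ∀ d → Remainders G d → Remainders (glue G) (glue-layout G d)
glue-remainders G wf d (rA , rB , rC) =
  GlueA.result G wf d rA rB rC , GlueB.result G wf d rA rB rC , GlueC.result G wf d rA rB rC

-- The Sierpiński graphs

consec? : ∀ q u v → Dec (Consec q u v)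
consec? [] u v = no λ ()
consec? (_ ∷ []) u v = no λ ()
consec? (a ∷ b ∷ r) u v = ((u ≟ a) ×-dec (v ≟ b)) ⊎-dec consec? (b ∷ r) u v

linked? : ∀ q u v → Dec (Linked q u v)
linked? q u v = consec? q u v ⊎-dec consec? q v u

adj? : ∀ G u v → Dec (Adj G u v)
adj? G u v = T? (adj G u v)

neighbour? : ∀ G v u → Dec (Neighbour G v u)
neighbour? G v u = (u ≟ v) ⊎-dec adj? G v u

RemainderCheck : Gr → List ℕ → List ℕ → Set
RemainderCheck G S p =
  Unique S × All (_∈ verts G) S × Unique p ×
  All (λ u → All (λ v → (Adj G u v → Linked p u v) × (Linked p u v → Adj G u v)) p) p ×
  All (_∈ verts G) p ×
  All (λ u → u ∈ p ⊎ Any (λ d → Neighbour G d u) S) (verts G) ×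
  All (λ u → All (λ d → ¬ Neighbour G d u) S) p ×
  All (λ v → v ∈ p ⊎ All (λ u → ¬ Adj G v u ⊎ Any (λ u' → u' ≢ u × Adj G v u') p) p) (verts G)

remainderCheck? : ∀ G S p → Dec (RemainderCheck G S p)
remainderCheck? G S p =
  unique? S ×-dec all? (_∈? verts G) S ×-dec unique? p ×-dec
  all? (λ u → all? (λ v → (adj? G u v →-dec linked? p u v) ×-dec (linked? p u v →-dec adj? G u v)) p) p ×-dec
  all? (_∈? verts G) p ×-dec
  all? (λ u → (u ∈? p) ⊎-dec any? (λ d → neighbour? G d u) S) (verts G) ×-dec
  all? (λ u → all? (λ d → ¬? (neighbour? G d u)) S) p ×-dec
  all? (λ v → (v ∈? p) ⊎-dec all? (λ u → ¬? (adj? G v u) ⊎-dec any? (λ u' → ¬? (u' ≟ u) ×-dec adj? G v u') p) p) (verts G)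

RemainderCheck⇒Remainder : ∀ {G S p} → RemainderCheck G S p → Remainder G S p
RemainderCheck⇒Remainder {G} {S} {p} (S-unique , S⊆V , p-unique , adj⇔ , p⊆V , covered , undominated , two-contacts) = record
  { S-unique = S-unique
  ; S⊆V = All.lookup S⊆V
  ; path = p-unique , λ u v mu mv → let (to , from) = All.lookup (All.lookup adj⇔ mu) mv in mk⇔ to from
  ; p⊆V = All.lookup p⊆V
  ; covered = Sum.map₂ find ∘ All.lookup covered
  ; undominated = λ up dS → All.lookup (All.lookup undominated up) dS
  ; two-contacts = contacts
  }
  where
    contacts : ∀ {v u} → v ∈ verts G → v ∉ p → u ∈ p → Adj G v u → ∃[ u' ] u' ∈ p × u' ≢ u × Adj G v u'
    contacts mv v∉p up vu with All.lookup two-contacts mv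
    ... | inj₁ v∈p = ⊥-elim (v∉p v∈p)
    ... | inj₂ all-u with All.lookup all-u up
    ... | inj₁ ¬vu = ⊥-elim (¬vu vu)
    ... | inj₂ other = let (u' , u'∈p , u'≢u , vu') = find other in u' , u'∈p , u'≢u , vu'

S₂ : Gr
S₂ = Sier' 1

S₂-wellFormed : WellFormed S₂
S₂-wellFormed = record
  { verts-unique = toWitness {a? = unique? (verts S₂)} _
  ; verts-bound = All.lookup (toWitness {a? = all? (_<? bound S₂) (verts S₂)} _)
  ; A∈V = toWitness {a? = A S₂ ∈? verts S₂} _
  ; B∈V = toWitness {a? = B S₂ ∈? verts S₂} _
  ; C∈V = toWitness {a? = C S₂ ∈? verts S₂} _
  ; A≢B = λ ()
  ; A≢C = λ ()
  ; B≢C = λ ()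
  ; irreflexive = λ {u} → no-loop {u}
  ; adj⇒∈V = λ {u} {v} → edge-in-V {u} {v}
  ; ¬adj-AB = λ ()
  ; ¬adj-AC = λ ()
  ; ¬adj-BC = λ ()
  }
  where
    loopless : All (λ e → proj₁ e ≢ proj₂ e) (edges S₂)
    loopless = toWitness {a? = all? (λ e → ¬? (proj₁ e ≟ proj₂ e)) (edges S₂)} _
    endpoints : All (λ e → proj₁ e ∈ verts S₂ × proj₂ e ∈ verts S₂) (edges S₂)
    endpoints = toWitness {a? = all? (λ e → (proj₁ e ∈? verts S₂) ×-dec (proj₂ e ∈? verts S₂)) (edges S₂)} _
    no-loop : ∀ {u} → ¬ Adj S₂ u u
    no-loop {u} uu = Sum.[ All.lookup loopless , All.lookup loopless ]′ (adj⇒edge S₂ {u} {u} uu) refl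
    edge-in-V : ∀ {u v} → Adj S₂ u v → u ∈ verts S₂
    edge-in-V {u} {v} uv = Sum.[ proj₁ ∘ All.lookup endpoints , proj₂ ∘ All.lookup endpoints ]′ (adj⇒edge S₂ {u} {v} uv)


S₂-N[A]⊆N[1] : ∀ {u} → Neighbour S₂ (A S₂) u → Neighbour S₂ 1 u
S₂-N[A]⊆N[1] {u} nb = All.lookup checked u∈V nb
  where
    checked : All (λ u → Neighbour S₂ 0 u → Neighbour S₂ 1 u) (verts S₂)
    checked = toWitness {a? = all? (λ u → neighbour? S₂ 0 u →-dec neighbour? S₂ 1 u) (verts S₂)} _
    u∈V : u ∈ verts S₂
    u∈V = Sum.[ (λ { refl → here refl })
              , (λ Au → WellFormed.adj⇒∈V S₂-wellFormed {u} {A S₂} (adj-sym S₂ {A S₂} {u} Au)) ]′ nb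

decide-remainder : ∀ S p → True (remainderCheck? S₂ S p) → Remainder S₂ S p
decide-remainder S p = RemainderCheck⇒Remainder ∘ toWitness

-- In S₂ the vertices are 0, 1, 2, 4, 5, 8 with corners A = 0, B = 4, C = 8.
layout₂ : Layout
layout₂ = layout [] [] [] (5 ∷ []) (2 ∷ []) (1 ∷ [])

S₂-remainders : Remainders S₂ layout₂
S₂-remainders = decide-remainder _ _ _ , decide-remainder _ _ _ , decide-remainder _ _ _

-- Sg k is 𝒮_{k+2}.
Sg : ℕ → Gr
Sg k = Sier' (suc k)

Sg-wellFormed : ∀ k → WellFormed (Sg k)
Sg-wellFormed zero = S₂-wellFormed
Sg-wellFormed (suc k) = GlueProperties.glue-wellFormed (Sg k) (Sg-wellFormed k)

layouts : ℕ → Layout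
layouts zero = layout₂
layouts (suc k) = glue-layout (Sg k) (layouts k)

Sg-remainders : ∀ k → Remainders (Sg k) (layouts k)
Sg-remainders zero = S₂-remainders
Sg-remainders (suc k) = glue-remainders (Sg k) (Sg-wellFormed k) (layouts k) (Sg-remainders k)

rest-size : ℕ → ℕ
rest-size zero = 0
rest-size (suc k) = rest-size k + (suc (rest-size k) + rest-size k)

rest-lengths : ∀ k → length (restA (layouts k)) ≡ rest-size k × length (restB (layouts k)) ≡ rest-size k ×
                     length (restC (layouts k)) ≡ rest-size k
rest-lengths zero = refl , refl , refl
rest-lengths (suc k) with rest-lengths k
... | ℓA , ℓB , ℓC =
  length-++₃ (restA d) (map (embed₂ G) (C G ∷ restC d)) (map (embed₃ G) (restB d))
    ℓA (trans (length-map _ (C G ∷ restC d)) (cong suc ℓC)) (trans (length-map _ (restB d)) ℓB) ,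
  length-++₃ (map (embed₂ G) (restB d)) (C G ∷ restC d) (map (embed₃ G) (restA d))
    (trans (length-map _ (restB d)) ℓB) (cong suc ℓC) (trans (length-map _ (restA d)) ℓA) ,
  length-++₃ (map (embed₃ G) (restC d)) (B G ∷ restB d) (map (embed₂ G) (restA d))
    (trans (length-map _ (restC d)) ℓC) (cong suc ℓB) (trans (length-map _ (restA d)) ℓA)
  where
    G : Gr
    G = Sg k
    d : Layout
    d = layouts k
    length-++₃ : ∀ (xs ys zs : List ℕ) {a b c} → length xs ≡ a → length ys ≡ b → length zs ≡ c →
                 length (xs ++ ys ++ zs) ≡ a + (b + c)
    length-++₃ xs ys zs ℓx ℓy ℓz = trans (length-++ xs) (cong₂ _+_ ℓx (trans (length-++ ys) (cong₂ _+_ ℓy ℓz)))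

3^≡rest-size : ∀ k → 3 ^ k ≡ rest-size k * 2 + 1
3^≡rest-size zero = refl
3^≡rest-size (suc k) = trans (cong (3 *_) (3^≡rest-size k)) (step (rest-size k))
  where
    step : ∀ r → 3 * (r * 2 + 1) ≡ (r + (suc r + r)) * 2 + 1
    step = solve-∀

seed-size : ∀ k → suc (rest-size k) ≡ (3 ^ k + 1) / 2
seed-size k = sym (begin
  (3 ^ k + 1) / 2             ≡⟨ cong (λ n → (n + 1) / 2) (3^≡rest-size k) ⟩
  (rest-size k * 2 + 1 + 1) / 2 ≡⟨ cong (_/ 2) (double (rest-size k)) ⟩
  (suc (rest-size k) * 2) / 2  ≡⟨ m*n/n≡m (suc (rest-size k)) 2 ⟩
  suc (rest-size k)            ∎)
  where
    open ≡-Reasoning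
    double : ∀ r → r * 2 + 1 + 1 ≡ suc r * 2
    double = solve-∀

A≡0 : ∀ k → A (Sier' k) ≡ 0
A≡0 zero = refl
A≡0 (suc k) = A≡0 k

1∈V : ∀ k → 1 ∈ verts (Sg k)
1∈V zero = there (here refl)
1∈V (suc k) = GlueProperties.embed-∈ (Sg k) (Sg-wellFormed k) c₁ (1∈V k)

adj-lift : ∀ k {x y} → Adj S₂ x y → Adj (Sg k) x y
adj-lift zero xy = xy
adj-lift (suc k) {x} {y} xy = GlueProperties.embed-adj (Sg k) (Sg-wellFormed k) c₁ {x} {y} (adj-lift k xy)

N[A]⊆N[1] : ∀ k {u} → Neighbour (Sg k) (A (Sg k)) u → Neighbour (Sg k) 1 u
N[A]⊆N[1] zero = S₂-N[A]⊆N[1]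
N[A]⊆N[1] (suc k) {u} = Sum.map₂ (embed-adj c₁) ∘ N[A]⊆N[1] k ∘ Sum.map₂ adj-A⁻
  where open GlueProperties (Sg k) (Sg-wellFormed k)

1≢B : ∀ k → 1 ≢ B (Sg k)
1≢B zero ()
1≢B (suc k) = GlueProperties.∈V⇒≢B (Sg k) (Sg-wellFormed k) (1∈V k)

1≢C : ∀ k → 1 ≢ C (Sg k)
1≢C zero ()
1≢C (suc k) = GlueProperties.∈V⇒≢C (Sg k) (Sg-wellFormed k) (1∈V k)

1∉restA : ∀ k → 1 ∉ restA (layouts k)
1∉restA zero ()
1∉restA (suc k) m with ∈-++⁻ (restA (layouts k)) m
... | inj₁ m₁ = 1∉restA k m₁
... | inj₂ m₂ = Sum.[ in-copy₂ , in-copy₃ ]′ (∈-++⁻ (map (embed₂ (Sg k)) (C (Sg k) ∷ restC (layouts k))) m₂)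
  where
    open GlueProperties (Sg k) (Sg-wellFormed k)
    in-copy₂ : 1 ∉ map (embed₂ (Sg k)) (C (Sg k) ∷ restC (layouts k))
    in-copy₂ m₃ = let (c , _ , e) = ∈-map⁻ (embed₂ (Sg k)) {xs = C (Sg k) ∷ restC (layouts k)} m₃ in
                  1≢B k (proj₁ (glued₁₂ {b = c} (1∈V k) e))
    in-copy₃ : 1 ∉ map (embed₃ (Sg k)) (restB (layouts k))
    in-copy₃ m₃ = let (c , _ , e) = ∈-map⁻ (embed₃ (Sg k)) m₃ in 1≢C k (proj₁ (glued₁₃ {b = c} (1∈V k) e))

pathA : ℕ → List ℕ
pathA k = B (Sg k) ∷ (innerA (layouts k) ∷ʳ C (Sg k))

pathA-lift : ∀ k {x} → x ∈ pathA 0 → x ∈ pathA k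
pathA-lift zero m = m
pathA-lift (suc k) m with Sg-remainders k
... | rA , rB , rC = GlueA.pathA-extends (Sg k) (Sg-wellFormed k) (layouts k) rA rB rC (pathA-lift k m)

restA-seed-size : ∀ k → suc (length (restA (layouts k))) ≡ (3 ^ k + 1) / 2
restA-seed-size k = trans (cong suc (proj₁ (rest-lengths k))) (seed-size k)

Θ₁ Θ₂ : ℕ → List ℕ
Θ₁ k = A (Sg k) ∷ restA (layouts k)
Θ₂ k = 1 ∷ restA (layouts k)

Observed⇒InPinf : ∀ {G D u} → Observed G D u → InPinf G D u
Observed⇒InPinf (n , t) = n , Equivalence.to T-≡ t

module Conditions (k : ℕ) where
  G : Gr
  G = Sg k
  open WellFormed (Sg-wellFormed k)
  open Remainder (proj₁ (Sg-remainders k))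

  condition2 : Condition2 (suc (suc k)) (Θ₁ k)
  condition2 =
    (S-unique , All.tabulate S⊆V , restA-seed-size k) ,
    pathA k , B G , C G , inj₂ (inj₁ refl) , inj₂ (inj₂ refl) , B≢C ,
    remainderIsPath (proj₁ (Sg-remainders k)) refl , corner-off-path
    where
      corner-off-path : ∀ z → IsOut G z → z ∉ pathA k → z ∈ Θ₁ k
      corner-off-path z (inj₁ refl) _ = here refl
      corner-off-path z (inj₂ (inj₁ refl)) z∉p = ⊥-elim (z∉p (here refl))
      corner-off-path z (inj₂ (inj₂ refl)) z∉p = ⊥-elim (z∉p (last∈ _ _))

  Θ₂⊆V : All (_∈ verts G) (Θ₂ k)
  Θ₂⊆V = 1∈V k ∷ All.tabulate (S⊆V ∘ there)

  observed-off-path : ∀ {w} → w ∈ verts G → w ∉ pathA k → T (Pi G (Θ₂ k) 0 w)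
  observed-off-path mw w∉p with covered mw
  ... | inj₁ w∈p = ⊥-elim (w∉p w∈p)
  ... | inj₂ (d , here refl , nb) = P0⁺ G (Θ₂ k) (here refl) (∈-nbhd⁺ G 1 mw (N[A]⊆N[1] k nb))
  ... | inj₂ (d , there md , nb) = P0⁺ G (Θ₂ k) (there md) (∈-nbhd⁺ G d mw nb)

  4∈p : 4 ∈ pathA k
  4∈p = pathA-lift k (here refl)

  5∈p : 5 ∈ pathA k
  5∈p = pathA-lift k (there (here refl))

  observed-near-1 : ∀ {u} → u ∈ pathA k → Adj S₂ 1 u → T (Pi G (Θ₂ k) 0 u)
  observed-near-1 {u} up 1u = P0⁺ G (Θ₂ k) (here refl) (∈-nbhd⁺ G 1 (p⊆V up) (inj₂ (adj-lift k {1} {u} 1u)))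

  all-observed : ∀ v → v ∈ verts G → InPinf G (Θ₂ k) v
  all-observed v mv with v ∈? pathA k
  ... | no v∉p = 0 , Equivalence.to T-≡ (observed-off-path mv v∉p)
  ... | yes v∈p = Observed⇒InPinf (Sum.[ (λ c → along c p4 p5) , (λ c → along c p5 p4) ]′
                                         (Equivalence.to (proj₂ path 4 5 4∈p 5∈p) (adj-lift k {4} {5} tt)))
    where
      p4 : T (Pi G (Θ₂ k) 0 4)
      p4 = observed-near-1 4∈p tt
      p5 : T (Pi G (Θ₂ k) 0 5)
      p5 = observed-near-1 5∈p tt
      along : ∀ {a b} → Consec (pathA k) a b → T (Pi G (Θ₂ k) 0 a) → T (Pi G (Θ₂ k) 0 b) → Observed G (Θ₂ k) v
      along {a} {b} ab pa pb = observe-path verts-unique Θ₂⊆V path p⊆V observed-off-path {a} {b} {0} ab pa pb v∈p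

  corners-outside : ∀ z → IsOut G z → z ∉ Θ₂ k
  corners-outside z (inj₁ refl) (here e) with trans (sym (A≡0 (suc k))) e
  ... | ()
  corners-outside z (inj₁ refl) (there m) = Unique[x∷xs]⇒x∉xs S-unique m
  corners-outside z (inj₂ (inj₁ refl)) (here e) = 1≢B k (sym e)
  corners-outside z (inj₂ (inj₁ refl)) (there m) = undominated (here refl) (there m) (inj₁ refl)
  corners-outside z (inj₂ (inj₂ refl)) (here e) = 1≢C k (sym e)
  corners-outside z (inj₂ (inj₂ refl)) (there m) = undominated (last∈ _ _) (there m) (inj₁ refl)

  condition3 : Condition3 (suc (suc k)) (Θ₂ k)
  condition3 =
    (All.tabulate (λ m 1≡x → 1∉restA k (subst (_∈ restA (layouts k)) (sym 1≡x) m)) ∷ AllPairs.tail S-unique ,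
     Θ₂⊆V , restA-seed-size k) ,
    all-observed , corners-outside

lemma7 : (g : ℕ) → g ≥ 3 →
    Σ (List ℕ) λ Θ1 → Σ (List ℕ) λ Θ2 → Condition2 g Θ1 × Condition3 g Θ2
lemma7 (suc zero) (s≤s ())
lemma7 (suc (suc k)) _ = Θ₁ k , Θ₂ k , Conditions.condition2 k , Conditions.condition3 k
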